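{- Let \[ S(x,p)=\sum_{n\ge1}x^n\sum_{w}p^{\mathrm{sper}(w)}, \] where the inner sum is over all Catalan words $w$ of length $n$ avoiding the pattern $(\geq,\geq)$. Then \[ S(x, p)=\frac{1-p^2x-2p^3x^2-\sqrt{1-2p^2x+(p^4-4p^3)x^2}}{2p^3x^2}. \]
   Context: A Catalan word of length $n\ge 0$ is a sequence $w=w_1\cdots w_n$ of non-negative integers with $w_1=0$ and $0\le w_i\le w_{i-1}+1$ for $i=2,\dots,n$. It avoids the pattern $(\geq,\geq)$ if there is no index $i$ with $w_i\ge w_{i+1}\ge w_{i+2}$. To $w$ is associated the polyomino $P(w)$ with $n$ bottom-aligned columns, the $i$-th column consisting of $w_i+1$ unit cells. $\mathrm{sper}(w)$ is half the perimeter of $P(w)$, the perimeter being the number of cell edges of $P(w)$ not shared with another cell of $P(w)$. -}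

module Defs where

open import Data.Bool using (Bool; true; false; _∧_; not; if_then_else_)
open import Data.Nat using (ℕ; zero; suc; _+_; _∸_; _≤ᵇ_; _<ᵇ_; _≡ᵇ_; _/_)
open import Data.List using (List; []; _∷_; map; filter; length; upTo; concatMap)
open import Data.Nat.ListAction using (sum)
open import Data.Maybe using (Maybe; just; nothing)
open import Data.Integer using (ℤ; +_; -[1+_]) renaming (_+_ to _+ℤ_; _-_ to _-ℤ_; _*_ to _*ℤ_)
open import Relation.Nullary.Decidable using (does)
open import Data.Bool.Properties using (_≟_)
open import Relation.Binary.PropositionalEquality using (_≡_)

-- Catalan words (0-indexed lists: w = w₁ ⋯ wₙ is the list w₁ ∷ … ∷ wₙ ∷ [])

stepsOK : List ℕ → Bool
stepsOK (a ∷ b ∷ rest) = (b ≤ᵇ suc a) ∧ stepsOK (b ∷ rest)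
stepsOK _              = true

isCatalan : List ℕ → Bool
isCatalan []         = true
isCatalan (a ∷ rest) = (a ≡ᵇ 0) ∧ stepsOK (a ∷ rest)

avoidsGeGe : List ℕ → Bool
avoidsGeGe (a ∷ b ∷ c ∷ rest) =
  not ((b ≤ᵇ a) ∧ (c ≤ᵇ b)) ∧ avoidsGeGe (b ∷ c ∷ rest)
avoidsGeGe _ = true

allLists : ℕ → ℕ → List (List ℕ)
allLists zero    m = [] ∷ []
allLists (suc n) m = concatMap (λ a → map (a ∷_) (allLists n m)) (upTo m)

-- all Catalan words of length n avoiding (≥,≥)
-- (every Catalan word of length n has entries < n)
avoidingWords : ℕ → List (List ℕ)
avoidingWords n = filter (λ w → isCatalan w ∧ avoidsGeGe w ≟ true) (allLists n n)

-- The polyomino P(w): column i (0-indexed) has cells (i , j) for j = 0 … wᵢ.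

inP : List ℕ → ℕ → ℕ → Bool
inP []       i       j = false
inP (h ∷ w)  zero    j = j ≤ᵇ h
inP (h ∷ w)  (suc i) j = inP w i j

b2n : Bool → ℕ
b2n true  = 1
b2n false = 0

exposedEdges : List ℕ → ℕ → ℕ → ℕ
exposedEdges w i j =
    (if (i ≡ᵇ 0) then 1 else b2n (not (inP w (i ∸ 1) j)))
  + b2n (not (inP w (suc i) j))
  + (if (j ≡ᵇ 0) then 1 else b2n (not (inP w i (j ∸ 1))))
  + b2n (not (inP w i (suc j)))

perimeterFrom : List ℕ → ℕ → List ℕ → ℕ
perimeterFrom w i []       = 0
perimeterFrom w i (h ∷ hs) =
  sum (map (exposedEdges w i) (upTo (suc h))) + perimeterFrom w (suc i) hs

perimeter : List ℕ → ℕ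
perimeter w = perimeterFrom w 0 w

sper : List ℕ → ℕ
sper w = perimeter w / 2

-- Formal power series in x and p with integer coefficients:
-- F n k is the coefficient of xⁿ pᵏ.

Series : Set
Series = ℕ → ℕ → ℤ

sumℤ : List ℤ → ℤ
sumℤ []       = + 0
sumℤ (z ∷ zs) = z +ℤ sumℤ zs

_⊕_ : Series → Series → Series
(F ⊕ G) n k = F n k +ℤ G n k

_⊖_ : Series → Series → Series
(F ⊖ G) n k = F n k -ℤ G n k

_⊛_ : Series → Series → Series
(F ⊛ G) n k =
  sumℤ (map (λ i → sumℤ (map (λ j → F i j *ℤ G (n ∸ i) (k ∸ j)) (upTo (suc k))))
            (upTo (suc n)))

mono : ℤ → ℕ → ℕ → Series
mono c a b n k = if (n ≡ᵇ a) ∧ (k ≡ᵇ b) then c else + 0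

_≈ₛ_ : Series → Series → Set
F ≈ₛ G = ∀ n k → F n k ≡ G n k

IsSqrt : Series → Series → Set
IsSqrt R D = ((R ⊛ R) ≈ₛ D) Data.Product.× (R 0 0 ≡ + 1)
  where import Data.Product

S : Series
S zero    k = + 0
S (suc n) k = + length (filter (λ w → sper w Data.Nat.≟ k) (avoidingWords (suc n)))

A : Series
A = (mono (+ 1) 0 0 ⊖ mono (+ 1) 1 2) ⊖ mono (+ 2) 2 3

D : Series
D = ((mono (+ 1) 0 0 ⊖ mono (+ 2) 1 2) ⊕ mono (+ 1) 2 4) ⊖ mono (+ 4) 2 3

{-# OPTIONS --safe #-}
-- Let W = 1 + S count the (≥,≥)-avoiding Catalan words, the empty one included, by length (x) and
-- semiperimeter (p); for a Catalan word the semiperimeter is 1 + length + number of ascents.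
-- Cutting a nonempty word at its last 0 writes it as 0(β+1) or γ c 0 (β+1), with β and γ again
-- avoiding Catalan words; avoiding (≥,≥) at that 0 forces c to be the last letter of γ plus one
-- (c = 0 if γ is empty). Hence W = 1 + p²xW + p³x²W², so R = 1 − p²x − 2p³x²W, which is
-- A − 2p³x²S, satisfies R² = (1 − p²x)² − 4p³x² = D, and R has constant term 1.

module Submission where

open import Defs
open import Data.Bool using (Bool; true; false; _∧_; _∨_; not; if_then_else_)
import Data.Bool.Properties as Boolₚ
open import Data.Bool.Properties using (T-≡; ∧-assoc; ∧-zeroʳ; ∧-conicalˡ; ∧-conicalʳ)
open import Data.Bool.ListAction using (any)
open import Data.Empty using (⊥-elim)
open import Data.Maybe using (Maybe; just; nothing)
open import Data.Nat as ℕ using (ℕ; zero; suc; _∸_; _≤_; _<_; _≤ᵇ_; _≡ᵇ_; z≤n; s≤s)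
import Data.Nat.Properties as ℕₚ
import Data.Nat.Tactic.RingSolver as ℕ-Solver
open import Data.Nat.DivMod using (m*n/n≡m)
open import Data.Nat.ListAction using (sum)
open import Data.Integer using (ℤ; +_; -_; _+_; _-_; _*_)
import Data.Integer.Properties as ℤₚ
open import Data.Integer.Tactic.RingSolver using (solve-∀)
open import Data.List using (List; []; _∷_; _++_; map; upTo; concatMap; length; head; drop; filter)
import Data.List.Properties as Listₚ
open import Data.List.Membership.Propositional using (_∈_)
open import Data.List.Relation.Unary.Any using (here; there)
open import Data.Product using (_,_)
open import Function using (_∘_)
open import Function.Bundles using (Equivalence)
open import Relation.Nullary.Decidable using (does)
open import Relation.Unary using (Decidable)
open import Relation.Binary.PropositionalEquality
open ≡-Reasoning

-- Finite sums

⟦_⟧ : Bool → ℤ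
⟦ b ⟧ = + b2n b

∑ : {X : Set} → List X → (X → ℤ) → ℤ
∑ xs f = sumℤ (map f xs)

infix 5 ∑ ∑<

syntax ∑ xs (λ x → e) = ∑[ x ∈ xs ] e

∑< : ℕ → (ℕ → ℤ) → ℤ
∑< n = ∑ (upTo n)

syntax ∑< n (λ i → e) = ∑[ i < n ] e

private
  variable
    X Y : Set

∑-cong : ∀ (xs : List X) {f g : X → ℤ} → (∀ x → f x ≡ g x) → ∑ xs f ≡ ∑ xs g
∑-cong []       eq = refl
∑-cong (x ∷ xs) eq = cong₂ _+_ (eq x) (∑-cong xs eq)

∑-zero : ∀ (xs : List X) {f : X → ℤ} → (∀ x → f x ≡ + 0) → ∑ xs f ≡ + 0
∑-zero []       f≡0 = refl
∑-zero (x ∷ xs) f≡0 = cong₂ _+_ (f≡0 x) (∑-zero xs f≡0)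

∑-distrib-+ : ∀ (xs : List X) (f g : X → ℤ) → ∑[ x ∈ xs ] (f x + g x) ≡ ∑ xs f + ∑ xs g
∑-distrib-+ []       f g = refl
∑-distrib-+ (x ∷ xs) f g = begin
  (f x + g x) + (∑[ x ∈ xs ] f x + g x) ≡⟨ cong (_+_ (f x + g x)) (∑-distrib-+ xs f g) ⟩
  (f x + g x) + (∑ xs f + ∑ xs g)       ≡⟨ shuffle (f x) (g x) (∑ xs f) (∑ xs g) ⟩
  (f x + ∑ xs f) + (g x + ∑ xs g)       ∎
  where
  shuffle : ∀ a b c d → (a + b) + (c + d) ≡ (a + c) + (b + d)
  shuffle = solve-∀

∑-neg : ∀ (xs : List X) (f : X → ℤ) → ∑[ x ∈ xs ] - f x ≡ - ∑ xs f
∑-neg []       f = refl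
∑-neg (x ∷ xs) f = trans (cong (_+_ (- f x)) (∑-neg xs f)) (sym (ℤₚ.neg-distrib-+ (f x) (∑ xs f)))

*-distribˡ-∑ : ∀ c (xs : List X) (f : X → ℤ) → c * ∑ xs f ≡ ∑[ x ∈ xs ] c * f x
*-distribˡ-∑ c []       f = ℤₚ.*-zeroʳ c
*-distribˡ-∑ c (x ∷ xs) f = trans (ℤₚ.*-distribˡ-+ c (f x) (∑ xs f)) (cong (_+_ (c * f x)) (*-distribˡ-∑ c xs f))

∑-++ : ∀ (xs ys : List X) (f : X → ℤ) → ∑ (xs ++ ys) f ≡ ∑ xs f + ∑ ys f
∑-++ []       ys f = sym (ℤₚ.+-identityˡ (∑ ys f))
∑-++ (x ∷ xs) ys f = trans (cong (_+_ (f x)) (∑-++ xs ys f)) (sym (ℤₚ.+-assoc (f x) (∑ xs f) (∑ ys f)))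

∑-map : ∀ (g : X → Y) (xs : List X) (f : Y → ℤ) → ∑ (map g xs) f ≡ ∑ xs (f ∘ g)
∑-map g xs f = cong sumℤ (sym (Listₚ.map-∘ xs))

∑-concatMap : ∀ (g : X → List Y) (xs : List X) (f : Y → ℤ) →
              ∑ (concatMap g xs) f ≡ ∑[ x ∈ xs ] ∑ (g x) f
∑-concatMap g []       f = refl
∑-concatMap g (x ∷ xs) f = trans (∑-++ (g x) (concatMap g xs) f) (cong (_+_ (∑ (g x) f)) (∑-concatMap g xs f))

∑-comm : ∀ (xs : List X) (ys : List Y) (f : X → Y → ℤ) →
         ∑[ x ∈ xs ] ∑ ys (f x) ≡ ∑[ y ∈ ys ] ∑[ x ∈ xs ] f x y
∑-comm []       ys f = sym (∑-zero ys (λ _ → refl))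
∑-comm (x ∷ xs) ys f = trans (cong (_+_ (∑ ys (f x))) (∑-comm xs ys f))
                             (sym (∑-distrib-+ ys (f x) (λ y → ∑[ x ∈ xs ] f x y)))

∑-product : ∀ (xs : List X) (ys : List Y) (f : X → ℤ) (g : Y → ℤ) →
            ∑[ x ∈ xs ] ∑[ y ∈ ys ] f x * g y ≡ ∑ xs f * ∑ ys g
∑-product xs ys f g = begin
  ∑[ x ∈ xs ] ∑[ y ∈ ys ] f x * g y ≡⟨ ∑-cong xs (λ x → sym (*-distribˡ-∑ (f x) ys g)) ⟩
  ∑[ x ∈ xs ] f x * ∑ ys g           ≡⟨ ∑-cong xs (λ x → ℤₚ.*-comm (f x) (∑ ys g)) ⟩
  ∑[ x ∈ xs ] ∑ ys g * f x           ≡⟨ sym (*-distribˡ-∑ (∑ ys g) xs f) ⟩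
  ∑ ys g * ∑ xs f                    ≡⟨ ℤₚ.*-comm (∑ ys g) (∑ xs f) ⟩
  ∑ xs f * ∑ ys g                    ∎

∑-convolution : ∀ (xs : List X) (ys : List Y) h (f : ℕ → X → ℤ) (g : ℕ → Y → ℤ) →
  ∑[ x ∈ xs ] ∑[ y ∈ ys ] ∑[ j < suc h ] f j x * g (h ∸ j) y
    ≡ ∑[ j < suc h ] (∑[ x ∈ xs ] f j x) * (∑[ y ∈ ys ] g (h ∸ j) y)
∑-convolution xs ys h f g = begin
  ∑[ x ∈ xs ] ∑[ y ∈ ys ] ∑[ j < suc h ] f j x * g (h ∸ j) y
    ≡⟨ ∑-cong xs (λ x → ∑-comm ys (upTo (suc h)) (λ y j → f j x * g (h ∸ j) y)) ⟩
  ∑[ x ∈ xs ] ∑[ j < suc h ] ∑[ y ∈ ys ] f j x * g (h ∸ j) y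
    ≡⟨ ∑-comm xs (upTo (suc h)) (λ x j → ∑[ y ∈ ys ] f j x * g (h ∸ j) y) ⟩
  ∑[ j < suc h ] ∑[ x ∈ xs ] ∑[ y ∈ ys ] f j x * g (h ∸ j) y
    ≡⟨ ∑-cong (upTo (suc h)) (λ j → ∑-product xs ys (f j) (g (h ∸ j))) ⟩
  ∑[ j < suc h ] (∑[ x ∈ xs ] f j x) * (∑[ y ∈ ys ] g (h ∸ j) y) ∎

∑-filter : ∀ {P : X → Set} (P? : Decidable P) xs (f : X → ℤ) →
  ∑ (filter P? xs) f ≡ ∑[ x ∈ xs ] ⟦ does (P? x) ⟧ * f x
∑-filter P? []       f = refl
∑-filter P? (x ∷ xs) f with does (P? x)
... | true  = cong₂ _+_ (sym (ℤₚ.*-identityˡ (f x))) (∑-filter P? xs f)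
... | false = trans (∑-filter P? xs f) (sym (ℤₚ.+-identityˡ _))

+length : ∀ (xs : List X) → + length xs ≡ ∑[ _ ∈ xs ] + 1
+length []       = refl
+length (x ∷ xs) = cong (_+_ (+ 1)) (+length xs)

+sum : ∀ (f : X → ℕ) xs → + sum (map f xs) ≡ ∑[ x ∈ xs ] + f x
+sum f []       = refl
+sum f (x ∷ xs) = cong (_+_ (+ f x)) (+sum f xs)

∑<-suc : ∀ n (f : ℕ → ℤ) → ∑< (suc n) f ≡ f 0 + ∑< n (f ∘ suc)
∑<-suc n f = cong (λ xs → f 0 + sumℤ xs)
  (trans (Listₚ.map-applyUpTo suc f n) (sym (Listₚ.map-upTo (f ∘ suc) n)))

∑<-snoc : ∀ n (f : ℕ → ℤ) → ∑< (suc n) f ≡ ∑< n f + f n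
∑<-snoc n f = begin
  ∑ (upTo (suc n)) f          ≡⟨ cong (λ xs → ∑ xs f) (sym (Listₚ.upTo-∷ʳ n)) ⟩
  ∑ (upTo n ++ n ∷ []) f      ≡⟨ ∑-++ (upTo n) (n ∷ []) f ⟩
  ∑< n f + (f n + + 0)        ≡⟨ cong (_+_ (∑< n f)) (ℤₚ.+-identityʳ (f n)) ⟩
  ∑< n f + f n                ∎

∑<-cong-< : ∀ n {f g : ℕ → ℤ} → (∀ i → i < n → f i ≡ g i) → ∑< n f ≡ ∑< n g
∑<-cong-< zero    eq = refl
∑<-cong-< (suc n) {f} {g} eq = begin
  ∑< (suc n) f              ≡⟨ ∑<-suc n f ⟩
  f 0 + ∑< n (f ∘ suc)      ≡⟨ cong₂ _+_ (eq 0 (s≤s z≤n)) (∑<-cong-< n (λ i i<n → eq (suc i) (s≤s i<n))) ⟩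
  g 0 + ∑< n (g ∘ suc)      ≡⟨ sym (∑<-suc n g) ⟩
  ∑< (suc n) g              ∎

∑<-reverse : ∀ n (f : ℕ → ℤ) → ∑< n f ≡ ∑[ i < n ] f (n ∸ suc i)
∑<-reverse zero    f = refl
∑<-reverse (suc n) f = begin
  ∑< (suc n) f                       ≡⟨ ∑<-snoc n f ⟩
  ∑< n f + f n                       ≡⟨ cong (_+ f n) (∑<-reverse n f) ⟩
  (∑[ i < n ] f (n ∸ suc i)) + f n   ≡⟨ ℤₚ.+-comm _ (f n) ⟩
  f n + (∑[ i < n ] f (n ∸ suc i))   ≡⟨ sym (∑<-suc n (λ i → f (suc n ∸ suc i))) ⟩
  ∑[ i < suc n ] f (suc n ∸ suc i)   ∎

∑<-pick : ∀ n a {f : ℕ → ℤ} → a < n → (∀ i → (i ≡ᵇ a) ≡ false → f i ≡ + 0) → ∑< n f ≡ f a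
∑<-pick (suc n) zero    {f} _         others = begin
  ∑< (suc n) f            ≡⟨ ∑<-suc n f ⟩
  f 0 + ∑< n (f ∘ suc)    ≡⟨ cong (_+_ (f 0)) (∑-zero (upTo n) (λ i → others (suc i) refl)) ⟩
  f 0 + + 0               ≡⟨ ℤₚ.+-identityʳ (f 0) ⟩
  f 0                     ∎
∑<-pick (suc n) (suc a) {f} (s≤s a<n) others = begin
  ∑< (suc n) f            ≡⟨ ∑<-suc n f ⟩
  f 0 + ∑< n (f ∘ suc)    ≡⟨ cong₂ _+_ (others 0 refl) (∑<-pick n a a<n (others ∘ suc)) ⟩
  + 0 + f (suc a)         ≡⟨ ℤₚ.+-identityˡ (f (suc a)) ⟩
  f (suc a)               ∎

∑-const : ∀ n → ∑[ _ < n ] + 1 ≡ + n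
∑-const zero    = refl
∑-const (suc n) = trans (∑<-suc n (λ _ → + 1)) (cong (_+_ (+ 1)) (∑-const n))

⟦⟧-∧ : ∀ x y → ⟦ x ∧ y ⟧ ≡ ⟦ x ⟧ * ⟦ y ⟧
⟦⟧-∧ true  y = sym (ℤₚ.*-identityˡ ⟦ y ⟧)
⟦⟧-∧ false y = refl

⟦⟧-+≡ᵇ : ∀ s t k → ⟦ s ℕ.+ t ≡ᵇ k ⟧ ≡ ∑[ j < suc k ] ⟦ s ≡ᵇ j ⟧ * ⟦ t ≡ᵇ k ∸ j ⟧
⟦⟧-+≡ᵇ zero    t k       = begin
  ⟦ t ≡ᵇ k ⟧                                                ≡⟨ sym (ℤₚ.+-identityʳ ⟦ t ≡ᵇ k ⟧) ⟩
  ⟦ t ≡ᵇ k ⟧ + + 0                                          ≡⟨ sym (cong₂ _+_ (ℤₚ.*-identityˡ ⟦ t ≡ᵇ k ⟧)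
                                                                           (∑-zero (upTo k) (λ _ → refl))) ⟩
  + 1 * ⟦ t ≡ᵇ k ⟧ + (∑[ j < k ] + 0 * ⟦ t ≡ᵇ k ∸ suc j ⟧)  ≡⟨ sym (∑<-suc k (λ j → ⟦ 0 ≡ᵇ j ⟧ * ⟦ t ≡ᵇ k ∸ j ⟧)) ⟩
  ∑[ j < suc k ] ⟦ 0 ≡ᵇ j ⟧ * ⟦ t ≡ᵇ k ∸ j ⟧                ∎
⟦⟧-+≡ᵇ (suc s) t zero    = refl
⟦⟧-+≡ᵇ (suc s) t (suc k) = begin
  ⟦ s ℕ.+ t ≡ᵇ k ⟧                                          ≡⟨ ⟦⟧-+≡ᵇ s t k ⟩
  ∑[ j < suc k ] ⟦ s ≡ᵇ j ⟧ * ⟦ t ≡ᵇ k ∸ j ⟧                ≡⟨ sym (ℤₚ.+-identityˡ _) ⟩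
  + 0 + (∑[ j < suc k ] ⟦ s ≡ᵇ j ⟧ * ⟦ t ≡ᵇ k ∸ j ⟧)        ≡⟨ sym (∑<-suc (suc k) (λ j → ⟦ suc s ≡ᵇ j ⟧ * ⟦ t ≡ᵇ suc k ∸ j ⟧)) ⟩
  ∑[ j < suc (suc k) ] ⟦ suc s ≡ᵇ j ⟧ * ⟦ t ≡ᵇ suc k ∸ j ⟧  ∎

guarded : ∀ x {y z : Bool} → (x ≡ true → y ≡ z) → x ∧ y ≡ x ∧ z
guarded true  y≡z = y≡z refl
guarded false y≡z = refl

-- Formal power series

delay : ℕ → (ℕ → ℤ) → ℕ → ℤ
delay zero    f n       = f n
delay (suc a) f zero    = + 0
delay (suc a) f (suc n) = delay a f n

delay-cong : ∀ a {f g : ℕ → ℤ} → (∀ i → f i ≡ g i) → ∀ n → delay a f n ≡ delay a g n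
delay-cong zero    eq n       = eq n
delay-cong (suc a) eq zero    = refl
delay-cong (suc a) eq (suc n) = delay-cong a eq n

delay-zero : ∀ a n → delay a (λ _ → + 0) n ≡ + 0
delay-zero zero    n       = refl
delay-zero (suc a) zero    = refl
delay-zero (suc a) (suc n) = delay-zero a n

delay-map : (op : ℤ → ℤ) → op (+ 0) ≡ + 0 →
            ∀ a (f : ℕ → ℤ) n → delay a (op ∘ f) n ≡ op (delay a f n)
delay-map op op0 zero    f n       = refl
delay-map op op0 (suc a) f zero    = sym op0
delay-map op op0 (suc a) f (suc n) = delay-map op op0 a f n

delay-map₂ : (op : ℤ → ℤ → ℤ) → op (+ 0) (+ 0) ≡ + 0 →
             ∀ a (f g : ℕ → ℤ) n → delay a (λ i → op (f i) (g i)) n ≡ op (delay a f n) (delay a g n)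
delay-map₂ op op0 zero    f g n       = refl
delay-map₂ op op0 (suc a) f g zero    = sym op0
delay-map₂ op op0 (suc a) f g (suc n) = delay-map₂ op op0 a f g n

delay-∑ : ∀ a (xs : List X) (f : ℕ → X → ℤ) n →
          delay a (λ i → ∑ xs (f i)) n ≡ ∑[ x ∈ xs ] delay a (λ i → f i x) n
delay-∑ zero    xs f n       = refl
delay-∑ (suc a) xs f zero    = sym (∑-zero xs (λ _ → refl))
delay-∑ (suc a) xs f (suc n) = delay-∑ a xs f n

delay-delay : ∀ a c (f : ℕ → ℤ) n → delay a (delay c f) n ≡ delay (a ℕ.+ c) f n
delay-delay zero    c f n       = refl
delay-delay (suc a) c f zero    = refl
delay-delay (suc a) c f (suc n) = delay-delay a c f n

delay-comm : ∀ a b (F : ℕ → ℕ → ℤ) n k →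
             delay b (λ l → delay a (λ m → F m l) n) k ≡ delay a (λ m → delay b (F m) k) n
delay-comm zero    b F n       k = refl
delay-comm (suc a) b F zero    k = delay-zero b k
delay-comm (suc a) b F (suc n) k = delay-comm a b F n k

delay-convolution : ∀ a (f : ℕ → ℕ → ℤ) n →
  ∑[ i < suc n ] delay a (λ i′ → f i′ (n ∸ i)) i ≡ delay a (λ m → ∑[ i < suc m ] f i (m ∸ i)) n
delay-convolution zero    f n       = refl
delay-convolution (suc a) f zero    = refl
delay-convolution (suc a) f (suc n) = begin
  ∑[ i < suc (suc n) ] delay (suc a) (λ i′ → f i′ (suc n ∸ i)) i
    ≡⟨ ∑<-suc (suc n) (λ i → delay (suc a) (λ i′ → f i′ (suc n ∸ i)) i) ⟩
  + 0 + (∑[ i < suc n ] delay a (λ i′ → f i′ (n ∸ i)) i)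
    ≡⟨ ℤₚ.+-identityˡ _ ⟩
  ∑[ i < suc n ] delay a (λ i′ → f i′ (n ∸ i)) i
    ≡⟨ delay-convolution a f n ⟩
  delay a (λ m → ∑[ i < suc m ] f i (m ∸ i)) n ∎

𝟏 : Series
𝟏 = mono (+ 1) 0 0

-- multiplication by the monomial xᵃ pᵇ
shift : ℕ → ℕ → Series → Series
shift a b F n k = delay a (λ m → delay b (F m) k) n

shift-cong : ∀ a b {F G} → F ≈ₛ G → shift a b F ≈ₛ shift a b G
shift-cong a b F≈G n k = delay-cong a (λ m → delay-cong b (F≈G m) k) n

shift-⊕ : ∀ a b F G → shift a b (F ⊕ G) ≈ₛ (shift a b F ⊕ shift a b G)
shift-⊕ a b F G n k =
  trans (delay-cong a (λ m → delay-map₂ _+_ refl b (F m) (G m) k) n) (delay-map₂ _+_ refl a _ _ n)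

shift-⊖ : ∀ a b F G → shift a b (F ⊖ G) ≈ₛ (shift a b F ⊖ shift a b G)
shift-⊖ a b F G n k =
  trans (delay-cong a (λ m → delay-map₂ _-_ refl b (F m) (G m) k) n) (delay-map₂ _-_ refl a _ _ n)

shift-scale : ∀ a b c F n k → shift a b (λ m l → c * F m l) n k ≡ c * shift a b F n k
shift-scale a b c F n k =
  trans (delay-cong a (λ m → delay-map (c *_) (ℤₚ.*-zeroʳ c) b (F m) k) n)
        (delay-map (c *_) (ℤₚ.*-zeroʳ c) a _ n)

shift-shift : ∀ a b c d F → shift a b (shift c d F) ≈ₛ shift (a ℕ.+ c) (b ℕ.+ d) F
shift-shift a b c d F n k = begin
  delay a (λ m → delay b (λ l → delay c (λ m′ → delay d (F m′) l) m) k) n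
    ≡⟨ delay-cong a (λ m → delay-comm c b (λ m′ → delay d (F m′)) m k) n ⟩
  delay a (delay c (λ m′ → delay b (delay d (F m′)) k)) n
    ≡⟨ delay-cong a (delay-cong c (λ m′ → delay-delay b d (F m′) k)) n ⟩
  delay a (delay c (λ m′ → delay (b ℕ.+ d) (F m′) k)) n
    ≡⟨ delay-delay a c _ n ⟩
  shift (a ℕ.+ c) (b ℕ.+ d) F n k ∎

shift-comm : ∀ a b c d F → shift a b (shift c d F) ≈ₛ shift c d (shift a b F)
shift-comm a b c d F n k = begin
  shift a b (shift c d F) n k           ≡⟨ shift-shift a b c d F n k ⟩
  shift (a ℕ.+ c) (b ℕ.+ d) F n k       ≡⟨ cong₂ (λ x y → shift x y F n k) (ℕₚ.+-comm a c) (ℕₚ.+-comm b d) ⟩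
  shift (c ℕ.+ a) (d ℕ.+ b) F n k       ≡⟨ sym (shift-shift c d a b F n k) ⟩
  shift c d (shift a b F) n k           ∎

mono-shift : ∀ c a b → mono c a b ≈ₛ shift a b (mono c 0 0)
mono-shift c (suc a) b       (suc n) k       = mono-shift c a b n k
mono-shift c (suc a) b       zero    k       = refl
mono-shift c zero    b       (suc n) k       = sym (delay-zero b k)
mono-shift c zero    (suc b) zero    (suc k) = mono-shift c zero b zero k
mono-shift c zero    (suc b) zero    zero    = refl
mono-shift c zero    zero    zero    k       = refl

mono₀≈ : ∀ c n k → mono c 0 0 n k ≡ c * 𝟏 n k
mono₀≈ c zero    zero    = sym (ℤₚ.*-identityʳ c)
mono₀≈ c zero    (suc k) = sym (ℤₚ.*-zeroʳ c)
mono₀≈ c (suc n) k       = sym (ℤₚ.*-zeroʳ c)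

mono≈ : ∀ c a b n k → mono c a b n k ≡ c * shift a b 𝟏 n k
mono≈ c a b n k = begin
  mono c a b n k                          ≡⟨ mono-shift c a b n k ⟩
  shift a b (mono c 0 0) n k              ≡⟨ shift-cong a b (mono₀≈ c) n k ⟩
  shift a b (λ m l → c * 𝟏 m l) n k       ≡⟨ shift-scale a b c 𝟏 n k ⟩
  c * shift a b 𝟏 n k                     ∎

⊛-cong : ∀ {F F′ G G′} → F ≈ₛ F′ → G ≈ₛ G′ → (F ⊛ G) ≈ₛ (F′ ⊛ G′)
⊛-cong F≈F′ G≈G′ n k =
  ∑-cong (upTo (suc n)) (λ i → ∑-cong (upTo (suc k)) (λ j → cong₂ _*_ (F≈F′ i j) (G≈G′ (n ∸ i) (k ∸ j))))

⊛-comm : ∀ F G → (F ⊛ G) ≈ₛ (G ⊛ F)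
⊛-comm F G n k = begin
  ∑[ i < suc n ] ∑[ j < suc k ] term i j
    ≡⟨ ∑<-reverse (suc n) (λ i → ∑[ j < suc k ] term i j) ⟩
  ∑[ i < suc n ] ∑[ j < suc k ] term (n ∸ i) j
    ≡⟨ ∑-cong (upTo (suc n)) (λ i → ∑<-reverse (suc k) (term (n ∸ i))) ⟩
  ∑[ i < suc n ] ∑[ j < suc k ] term (n ∸ i) (k ∸ j)
    ≡⟨ ∑<-cong-< (suc n) (λ i i≤n → ∑<-cong-< (suc k) (λ j j≤k → reflected i j (ℕₚ.≤-pred i≤n) (ℕₚ.≤-pred j≤k))) ⟩
  ∑[ i < suc n ] ∑[ j < suc k ] G i j * F (n ∸ i) (k ∸ j) ∎
  where
  term : ℕ → ℕ → ℤ
  term i j = F i j * G (n ∸ i) (k ∸ j)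
  reflected : ∀ i j → i ≤ n → j ≤ k → term (n ∸ i) (k ∸ j) ≡ G i j * F (n ∸ i) (k ∸ j)
  reflected i j i≤n j≤k =
    trans (cong₂ (λ i′ j′ → F (n ∸ i) (k ∸ j) * G i′ j′) (ℕₚ.m∸[m∸n]≡n i≤n) (ℕₚ.m∸[m∸n]≡n j≤k))
          (ℤₚ.*-comm (F (n ∸ i) (k ∸ j)) (G i j))

⊛-distribʳ-⊕ : ∀ F G H → ((F ⊕ G) ⊛ H) ≈ₛ ((F ⊛ H) ⊕ (G ⊛ H))
⊛-distribʳ-⊕ F G H n k = begin
  ∑[ i < suc n ] ∑[ j < suc k ] (F i j + G i j) * H (n ∸ i) (k ∸ j)
    ≡⟨ ∑-cong (upTo (suc n)) (λ i → ∑-cong (upTo (suc k)) (λ j → ℤₚ.*-distribʳ-+ (H (n ∸ i) (k ∸ j)) (F i j) (G i j))) ⟩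
  ∑[ i < suc n ] ∑[ j < suc k ] (FH i j + GH i j)
    ≡⟨ ∑-cong (upTo (suc n)) (λ i → ∑-distrib-+ (upTo (suc k)) (FH i) (GH i)) ⟩
  ∑[ i < suc n ] ((∑[ j < suc k ] FH i j) + (∑[ j < suc k ] GH i j))
    ≡⟨ ∑-distrib-+ (upTo (suc n)) (λ i → ∑[ j < suc k ] FH i j) (λ i → ∑[ j < suc k ] GH i j) ⟩
  (F ⊛ H) n k + (G ⊛ H) n k ∎
  where
  FH GH : ℕ → ℕ → ℤ
  FH i j = F i j * H (n ∸ i) (k ∸ j)
  GH i j = G i j * H (n ∸ i) (k ∸ j)

⊛-distribʳ-⊖ : ∀ F G H → ((F ⊖ G) ⊛ H) ≈ₛ ((F ⊛ H) ⊖ (G ⊛ H))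
⊛-distribʳ-⊖ F G H n k = begin
  ((F ⊖ G) ⊛ H) n k                                  ≡⟨ ⊛-distribʳ-⊕ F (λ i j → - G i j) H n k ⟩
  (F ⊛ H) n k + ((λ i j → - G i j) ⊛ H) n k          ≡⟨ cong (_+_ ((F ⊛ H) n k)) neg-⊛ ⟩
  (F ⊛ H) n k - (G ⊛ H) n k                          ∎
  where
  GH : ℕ → ℕ → ℤ
  GH i j = G i j * H (n ∸ i) (k ∸ j)
  neg-⊛ : ((λ i j → - G i j) ⊛ H) n k ≡ - (G ⊛ H) n k
  neg-⊛ = begin
    ∑[ i < suc n ] ∑[ j < suc k ] - G i j * H (n ∸ i) (k ∸ j)
      ≡⟨ ∑-cong (upTo (suc n)) (λ i → ∑-cong (upTo (suc k)) (λ j → sym (ℤₚ.neg-distribˡ-* (G i j) (H (n ∸ i) (k ∸ j))))) ⟩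
    ∑[ i < suc n ] ∑[ j < suc k ] - (G i j * H (n ∸ i) (k ∸ j))
      ≡⟨ ∑-cong (upTo (suc n)) (λ i → ∑-neg (upTo (suc k)) (GH i)) ⟩
    ∑[ i < suc n ] - (∑[ j < suc k ] GH i j)
      ≡⟨ ∑-neg (upTo (suc n)) (λ i → ∑[ j < suc k ] GH i j) ⟩
    - (G ⊛ H) n k ∎

shift-⊛ : ∀ a b F G → (shift a b F ⊛ G) ≈ₛ shift a b (F ⊛ G)
shift-⊛ a b F G n k = begin
  ∑[ i < suc n ] ∑[ j < suc k ] delay a (λ i′ → delay b (F i′) j) i * G (n ∸ i) (k ∸ j)
    ≡⟨ ∑-cong (upTo (suc n)) (λ i → ∑-cong (upTo (suc k)) (λ j →
         sym (delay-map (_* G (n ∸ i) (k ∸ j)) refl a (λ i′ → delay b (F i′) j) i))) ⟩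
  ∑[ i < suc n ] ∑[ j < suc k ] delay a (λ i′ → delay b (F i′) j * G (n ∸ i) (k ∸ j)) i
    ≡⟨ ∑-cong (upTo (suc n)) (λ i → sym (delay-∑ a (upTo (suc k)) (λ i′ j → delay b (F i′) j * G (n ∸ i) (k ∸ j)) i)) ⟩
  ∑[ i < suc n ] delay a (λ i′ → ∑[ j < suc k ] delay b (F i′) j * G (n ∸ i) (k ∸ j)) i
    ≡⟨ delay-convolution a (λ i′ m → ∑[ j < suc k ] delay b (F i′) j * G m (k ∸ j)) n ⟩
  delay a (λ m → ∑[ i < suc m ] ∑[ j < suc k ] delay b (F i) j * G (m ∸ i) (k ∸ j)) n
    ≡⟨ delay-cong a (λ m → ∑-cong (upTo (suc m)) (λ i → inner m i)) n ⟩
  delay a (λ m → ∑[ i < suc m ] delay b (λ l → ∑[ j < suc l ] F i j * G (m ∸ i) (l ∸ j)) k) n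
    ≡⟨ delay-cong a (λ m → sym (delay-∑ b (upTo (suc m)) (λ l i → ∑[ j < suc l ] F i j * G (m ∸ i) (l ∸ j)) k)) n ⟩
  shift a b (F ⊛ G) n k ∎
  where
  inner : ∀ m i → ∑[ j < suc k ] delay b (F i) j * G (m ∸ i) (k ∸ j)
                ≡ delay b (λ l → ∑[ j < suc l ] F i j * G (m ∸ i) (l ∸ j)) k
  inner m i = trans (∑-cong (upTo (suc k)) (λ j → sym (delay-map (_* G (m ∸ i) (k ∸ j)) refl b (F i) j)))
                    (delay-convolution b (λ j l → F i j * G (m ∸ i) l) k)

mono₀-⊛ : ∀ c F n k → (mono c 0 0 ⊛ F) n k ≡ c * F n k
mono₀-⊛ c F n k = begin
  ∑[ i < suc n ] ∑[ j < suc k ] mono c 0 0 i j * F (n ∸ i) (k ∸ j)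
    ≡⟨ ∑<-suc n (λ i → ∑[ j < suc k ] mono c 0 0 i j * F (n ∸ i) (k ∸ j)) ⟩
  (∑[ j < suc k ] mono c 0 0 0 j * F n (k ∸ j)) + (∑[ i < n ] ∑[ j < suc k ] + 0 * F (n ∸ suc i) (k ∸ j))
    ≡⟨ cong₂ _+_ (∑<-suc k (λ j → mono c 0 0 0 j * F n (k ∸ j))) (∑-zero (upTo n) (λ i → ∑-zero (upTo (suc k)) (λ j → refl))) ⟩
  (c * F n k + (∑[ j < k ] + 0 * F n (k ∸ suc j))) + + 0
    ≡⟨ cong (λ z → (c * F n k + z) + + 0) (∑-zero (upTo k) (λ j → refl)) ⟩
  (c * F n k + + 0) + + 0
    ≡⟨ trans (ℤₚ.+-identityʳ _) (ℤₚ.+-identityʳ _) ⟩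
  c * F n k ∎

mono-⊛ : ∀ c a b F n k → (mono c a b ⊛ F) n k ≡ c * shift a b F n k
mono-⊛ c a b F n k = begin
  (mono c a b ⊛ F) n k                    ≡⟨ ⊛-cong {G = F} (mono-shift c a b) (λ _ _ → refl) n k ⟩
  (shift a b (mono c 0 0) ⊛ F) n k        ≡⟨ shift-⊛ a b (mono c 0 0) F n k ⟩
  shift a b (mono c 0 0 ⊛ F) n k          ≡⟨ shift-cong a b (mono₀-⊛ c F) n k ⟩
  shift a b (λ m l → c * F m l) n k       ≡⟨ shift-scale a b c F n k ⟩
  c * shift a b F n k                     ∎

-- Multiplication by u = xᵃpᵇ and by v = xᶜpᵈ is a shift.
quadratic-root : ∀ a b c d T → T ≈ₛ ((𝟏 ⊕ shift a b T) ⊕ shift c d (T ⊛ T)) →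
  let R = (𝟏 ⊖ shift a b 𝟏) ⊖ (shift c d T ⊕ shift c d T) in
  ∀ n k → (R ⊛ R) n k ≡ ((𝟏 n k - + 2 * shift a b 𝟏 n k) + shift (a ℕ.+ a) (b ℕ.+ b) 𝟏 n k) - + 4 * shift c d 𝟏 n k
quadratic-root a b c d T T-eq n k = begin
  (R ⊛ R) n k
    ≡⟨ R⊛ R n k ⟩
  (R n k - U R n k) - (V (T ⊛ R) n k + V (T ⊛ R) n k)
    ≡⟨ cong₂ (λ x y → (R n k - x) - (y + y)) UR VTR ⟩
  (R n k - ((U 𝟏 n k - U (U 𝟏) n k) - (U (V T) n k + U (V T) n k)))
    - ((((V 𝟏 n k + V 𝟏 n k) - V T n k) + U (V T) n k) + (((V 𝟏 n k + V 𝟏 n k) - V T n k) + U (V T) n k))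
    ≡⟨ collect (𝟏 n k) (U 𝟏 n k) (U (U 𝟏) n k) (V 𝟏 n k) (V T n k) (U (V T) n k) ⟩
  ((𝟏 n k - + 2 * U 𝟏 n k) + U (U 𝟏) n k) - + 4 * V 𝟏 n k
    ≡⟨ cong (λ x → ((𝟏 n k - + 2 * U 𝟏 n k) + x) - + 4 * V 𝟏 n k) (shift-shift a b a b 𝟏 n k) ⟩
  ((𝟏 n k - + 2 * U 𝟏 n k) + shift (a ℕ.+ a) (b ℕ.+ b) 𝟏 n k) - + 4 * V 𝟏 n k ∎
  where
  U V : Series → Series
  U = shift a b
  V = shift c d
  R : Series
  R = (𝟏 ⊖ U 𝟏) ⊖ (V T ⊕ V T)

  𝟏⊛ : ∀ H → (𝟏 ⊛ H) ≈ₛ H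
  𝟏⊛ H n k = trans (mono₀-⊛ (+ 1) H n k) (ℤₚ.*-identityˡ (H n k))

  R⊛ : ∀ H n k → (R ⊛ H) n k ≡ (H n k - U H n k) - (V (T ⊛ H) n k + V (T ⊛ H) n k)
  R⊛ H n k = begin
    (R ⊛ H) n k
      ≡⟨ ⊛-distribʳ-⊖ (𝟏 ⊖ U 𝟏) (V T ⊕ V T) H n k ⟩
    ((𝟏 ⊖ U 𝟏) ⊛ H) n k - ((V T ⊕ V T) ⊛ H) n k
      ≡⟨ cong₂ _-_ (⊛-distribʳ-⊖ 𝟏 (U 𝟏) H n k) (⊛-distribʳ-⊕ (V T) (V T) H n k) ⟩
    ((𝟏 ⊛ H) n k - (U 𝟏 ⊛ H) n k) - ((V T ⊛ H) n k + (V T ⊛ H) n k)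
      ≡⟨ cong₂ (λ x y → (x - y) - ((V T ⊛ H) n k + (V T ⊛ H) n k))
               (𝟏⊛ H n k) (trans (shift-⊛ a b 𝟏 H n k) (shift-cong a b (𝟏⊛ H) n k)) ⟩
    (H n k - U H n k) - ((V T ⊛ H) n k + (V T ⊛ H) n k)
      ≡⟨ cong (λ x → (H n k - U H n k) - (x + x)) (shift-⊛ c d T H n k) ⟩
    (H n k - U H n k) - (V (T ⊛ H) n k + V (T ⊛ H) n k) ∎

  eliminate : ∀ t e u x → t ≡ (e + u) + x → (t - u) - (x + x) ≡ ((e + e) - t) + u
  eliminate t e u x t≡ = begin
    (t - u) - (x + x)                   ≡⟨ cong (λ t → (t - u) - (x + x)) t≡ ⟩
    (((e + u) + x) - u) - (x + x)       ≡⟨ identity e u x ⟩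
    ((e + e) - ((e + u) + x)) + u       ≡⟨ cong (λ t → ((e + e) - t) + u) (sym t≡) ⟩
    ((e + e) - t) + u                   ∎
    where
    identity : ∀ e u x → (((e + u) + x) - u) - (x + x) ≡ ((e + e) - ((e + u) + x)) + u
    identity = solve-∀

  T⊛R : (T ⊛ R) ≈ₛ (((𝟏 ⊕ 𝟏) ⊖ T) ⊕ U T)
  T⊛R n k = begin
    (T ⊛ R) n k                                          ≡⟨ ⊛-comm T R n k ⟩
    (R ⊛ T) n k                                          ≡⟨ R⊛ T n k ⟩
    (T n k - U T n k) - (V (T ⊛ T) n k + V (T ⊛ T) n k)  ≡⟨ eliminate (T n k) (𝟏 n k) (U T n k) (V (T ⊛ T) n k) (T-eq n k) ⟩
    ((𝟏 n k + 𝟏 n k) - T n k) + U T n k                  ∎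

  UR : U R n k ≡ (U 𝟏 n k - U (U 𝟏) n k) - (U (V T) n k + U (V T) n k)
  UR = begin
    U R n k                                                   ≡⟨ shift-⊖ a b (𝟏 ⊖ U 𝟏) (V T ⊕ V T) n k ⟩
    U (𝟏 ⊖ U 𝟏) n k - U (V T ⊕ V T) n k                       ≡⟨ cong₂ _-_ (shift-⊖ a b 𝟏 (U 𝟏) n k) (shift-⊕ a b (V T) (V T) n k) ⟩
    (U 𝟏 n k - U (U 𝟏) n k) - (U (V T) n k + U (V T) n k)     ∎

  VTR : V (T ⊛ R) n k ≡ ((V 𝟏 n k + V 𝟏 n k) - V T n k) + U (V T) n k
  VTR = begin
    V (T ⊛ R) n k                                   ≡⟨ shift-cong c d T⊛R n k ⟩
    V (((𝟏 ⊕ 𝟏) ⊖ T) ⊕ U T) n k                     ≡⟨ shift-⊕ c d ((𝟏 ⊕ 𝟏) ⊖ T) (U T) n k ⟩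
    V ((𝟏 ⊕ 𝟏) ⊖ T) n k + V (U T) n k               ≡⟨ cong₂ _+_ (trans (shift-⊖ c d (𝟏 ⊕ 𝟏) T n k)
                                                                        (cong (_- V T n k) (shift-⊕ c d 𝟏 𝟏 n k)))
                                                                 (shift-comm c d a b T n k) ⟩
    ((V 𝟏 n k + V 𝟏 n k) - V T n k) + U (V T) n k   ∎

  collect : ∀ e u uu v vT uvT →
    (((e - u) - (vT + vT)) - ((u - uu) - (uvT + uvT))) - ((((v + v) - vT) + uvT) + (((v + v) - vT) + uvT))
    ≡ ((e - + 2 * u) + uu) - + 4 * v
  collect = solve-∀

-- Perimeter of a bar graph

≤⇒≤ᵇ : ∀ {m n} → m ≤ n → (m ≤ᵇ n) ≡ true
≤⇒≤ᵇ m≤n = Equivalence.to T-≡ (ℕₚ.≤⇒≤ᵇ m≤n)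

≤ᵇ⇒≤ : ∀ m n → (m ≤ᵇ n) ≡ true → m ≤ n
≤ᵇ⇒≤ m n m≤ᵇn = ℕₚ.≤ᵇ⇒≤ m n (Equivalence.from T-≡ m≤ᵇn)

1+n≤ᵇn : ∀ n → (suc n ≤ᵇ n) ≡ false
1+n≤ᵇn zero    = refl
1+n≤ᵇn (suc n) = 1+n≤ᵇn n

1+m≤ᵇ1+n : ∀ m n → (suc m ≤ᵇ suc n) ≡ (m ≤ᵇ n)
1+m≤ᵇ1+n zero    n = refl
1+m≤ᵇ1+n (suc m) n = refl

≡ᵇ-refl : ∀ n → (n ≡ᵇ n) ≡ true
≡ᵇ-refl zero    = refl
≡ᵇ-refl (suc n) = ≡ᵇ-refl n

inColumn : Maybe ℕ → ℕ → Bool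
inColumn nothing  j = false
inColumn (just h) j = j ≤ᵇ h

inP-drop : ∀ w i j → inP w i j ≡ inColumn (head (drop i w)) j
inP-drop []      zero    j = refl
inP-drop []      (suc i) j = refl
inP-drop (h ∷ w) zero    j = refl
inP-drop (h ∷ w) (suc i) j = inP-drop w i j

-- cells of a column of height h + 1 not covered by the neighbouring column c (nothing: no neighbour)
exposure : Maybe ℕ → ℕ → ℕ
exposure nothing  h = suc h
exposure (just p) h = h ∸ p

leftColumn : List ℕ → ℕ → Maybe ℕ
leftColumn w zero    = nothing
leftColumn w (suc i) = head (drop i w)

∑-uncovered : ∀ c h → ∑[ j < suc h ] ⟦ not (inColumn c j) ⟧ ≡ + exposure c h
∑-uncovered nothing  h = ∑-const (suc h)
∑-uncovered (just p) zero    = cong +_ (sym (ℕₚ.0∸n≡0 p))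
∑-uncovered (just p) (suc h) = begin
  ∑[ j < suc (suc h) ] ⟦ not (j ≤ᵇ p) ⟧               ≡⟨ ∑<-snoc (suc h) (λ j → ⟦ not (j ≤ᵇ p) ⟧) ⟩
  (∑[ j < suc h ] ⟦ not (j ≤ᵇ p) ⟧) + ⟦ not (suc h ≤ᵇ p) ⟧ ≡⟨ cong (_+ ⟦ not (suc h ≤ᵇ p) ⟧) (∑-uncovered (just p) h) ⟩
  + (h ∸ p) + ⟦ not (suc h ≤ᵇ p) ⟧                      ≡⟨ cong +_ (step h p) ⟩
  + (suc h ∸ p)                                          ∎
  where
  step : ∀ h p → (h ∸ p) ℕ.+ b2n (not (suc h ≤ᵇ p)) ≡ suc h ∸ p
  step zero    zero    = refl
  step zero    (suc p) = sym (ℕₚ.0∸n≡0 p)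
  step (suc h) zero    = ℕₚ.+-comm (suc h) 1
  step (suc h) (suc p) = step h p

one-bottom-edge : ∀ h → ∑[ j < suc h ] + (if j ≡ᵇ 0 then 1 else b2n (not ((j ∸ 1) ≤ᵇ h))) ≡ + 1
one-bottom-edge h = begin
  ∑[ j < suc h ] + (if j ≡ᵇ 0 then 1 else b2n (not ((j ∸ 1) ≤ᵇ h)))
    ≡⟨ ∑<-suc h (λ j → + (if j ≡ᵇ 0 then 1 else b2n (not ((j ∸ 1) ≤ᵇ h)))) ⟩
  + 1 + (∑[ j < h ] ⟦ not (j ≤ᵇ h) ⟧)
    ≡⟨ cong (_+_ (+ 1)) (∑<-cong-< h (λ j j<h → cong (⟦_⟧ ∘ not) (≤⇒≤ᵇ (ℕₚ.<⇒≤ j<h)))) ⟩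
  + 1 + (∑[ j < h ] + 0)
    ≡⟨ cong (_+_ (+ 1)) (∑-zero (upTo h) (λ _ → refl)) ⟩
  + 1 ∎

one-top-edge : ∀ h → ∑[ j < suc h ] ⟦ not (suc j ≤ᵇ h) ⟧ ≡ + 1
one-top-edge h = begin
  ∑[ j < suc h ] ⟦ not (suc j ≤ᵇ h) ⟧                    ≡⟨ ∑<-snoc h (λ j → ⟦ not (suc j ≤ᵇ h) ⟧) ⟩
  (∑[ j < h ] ⟦ not (suc j ≤ᵇ h) ⟧) + ⟦ not (suc h ≤ᵇ h) ⟧ ≡⟨ cong₂ _+_ (∑<-cong-< h (λ j j<h → cong (⟦_⟧ ∘ not) (≤⇒≤ᵇ j<h)))
                                                                        (cong (⟦_⟧ ∘ not) (1+n≤ᵇn h)) ⟩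
  (∑[ j < h ] + 0) + + 1                                   ≡⟨ cong (_+ + 1) (∑-zero (upTo h) (λ _ → refl)) ⟩
  + 1                                                      ∎

∑-left : ∀ w i h → ∑[ j < suc h ] + (if i ≡ᵇ 0 then 1 else b2n (not (inP w (i ∸ 1) j)))
                   ≡ + exposure (leftColumn w i) h
∑-left w zero    h = ∑-const (suc h)
∑-left w (suc i) h = trans (∑-cong (upTo (suc h)) (λ j → cong (⟦_⟧ ∘ not) (inP-drop w i j)))
                           (∑-uncovered (head (drop i w)) h)

column-edges : ∀ w i h → head (drop i w) ≡ just h →
  sum (map (exposedEdges w i) (upTo (suc h)))
    ≡ exposure (leftColumn w i) h ℕ.+ exposure (head (drop (suc i) w)) h ℕ.+ 2
column-edges w i h col = ℤₚ.+-injective (begin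
  + sum (map (exposedEdges w i) (upTo (suc h)))
    ≡⟨ +sum (exposedEdges w i) (upTo (suc h)) ⟩
  ∑[ j < suc h ] (((+ left j + + right j) + + bottom j) + + top j)
    ≡⟨ ∑-distrib-+ (upTo (suc h)) (λ j → (+ left j + + right j) + + bottom j) (+_ ∘ top) ⟩
  (∑[ j < suc h ] ((+ left j + + right j) + + bottom j)) + (∑[ j < suc h ] + top j)
    ≡⟨ cong (_+ (∑[ j < suc h ] + top j))
            (trans (∑-distrib-+ (upTo (suc h)) (λ j → + left j + + right j) (+_ ∘ bottom))
                   (cong (_+ (∑[ j < suc h ] + bottom j)) (∑-distrib-+ (upTo (suc h)) (+_ ∘ left) (+_ ∘ right)))) ⟩
  (((∑[ j < suc h ] + left j) + (∑[ j < suc h ] + right j)) + (∑[ j < suc h ] + bottom j)) + (∑[ j < suc h ] + top j)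
    ≡⟨ cong₂ _+_ (cong₂ _+_ (cong₂ _+_ (∑-left w i h) ∑-right) ∑-below) ∑-above ⟩
  ((+ exposure (leftColumn w i) h + + exposure (head (drop (suc i) w)) h) + + 1) + + 1
    ≡⟨ cong +_ (ℕₚ.+-assoc (exposure (leftColumn w i) h ℕ.+ exposure (head (drop (suc i) w)) h) 1 1) ⟩
  + (exposure (leftColumn w i) h ℕ.+ exposure (head (drop (suc i) w)) h ℕ.+ 2) ∎)
  where
  left right bottom top : ℕ → ℕ
  left   j = if (i ≡ᵇ 0) then 1 else b2n (not (inP w (i ∸ 1) j))
  right  j = b2n (not (inP w (suc i) j))
  bottom j = if (j ≡ᵇ 0) then 1 else b2n (not (inP w i (j ∸ 1)))
  top    j = b2n (not (inP w i (suc j)))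
  inOwnColumn : ∀ j → inP w i j ≡ (j ≤ᵇ h)
  inOwnColumn j = trans (inP-drop w i j) (cong (λ c → inColumn c j) col)
  ∑-right : ∑[ j < suc h ] + right j ≡ + exposure (head (drop (suc i) w)) h
  ∑-right = trans (∑-cong (upTo (suc h)) (λ j → cong (⟦_⟧ ∘ not) (inP-drop w (suc i) j)))
                  (∑-uncovered (head (drop (suc i) w)) h)
  ∑-below : ∑[ j < suc h ] + bottom j ≡ + 1
  ∑-below = trans (∑-cong (upTo (suc h)) (λ j → cong (λ b → + (if j ≡ᵇ 0 then 1 else b2n (not b))) (inOwnColumn (j ∸ 1))))
                    (one-bottom-edge h)
  ∑-above : ∑[ j < suc h ] + top j ≡ + 1
  ∑-above = trans (∑-cong (upTo (suc h)) (λ j → cong (⟦_⟧ ∘ not) (inOwnColumn (suc j)))) (one-top-edge h)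

perimeterAfter : Maybe ℕ → List ℕ → ℕ
perimeterAfter c []       = 0
perimeterAfter c (h ∷ hs) = exposure c h ℕ.+ exposure (head hs) h ℕ.+ 2 ℕ.+ perimeterAfter (just h) hs

drop-suc : ∀ i (w : List X) {h hs} → drop i w ≡ h ∷ hs → drop (suc i) w ≡ hs
drop-suc zero    (x ∷ w) refl = refl
drop-suc (suc i) (x ∷ w) eq   = drop-suc i w eq

perimeterFrom-drop : ∀ w i (hs : List ℕ) → drop i w ≡ hs → perimeterFrom w i hs ≡ perimeterAfter (leftColumn w i) hs
perimeterFrom-drop w i []       eq = refl
perimeterFrom-drop w i (h ∷ hs) eq = cong₂ ℕ._+_
  (trans (column-edges w i h (cong head eq))
         (cong (λ c → exposure (leftColumn w i) h ℕ.+ exposure (head c) h ℕ.+ 2) (drop-suc i w eq)))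
  (trans (perimeterFrom-drop w (suc i) hs (drop-suc i w eq))
         (cong (λ c → perimeterAfter c hs) (cong head eq)))

sperAfter : ℕ → List ℕ → ℕ
sperAfter p []      = 0
sperAfter p (b ∷ r) = suc (b2n (b ≡ᵇ suc p) ℕ.+ sperAfter b r)

semiperimeter : List ℕ → ℕ
semiperimeter []      = 0
semiperimeter (a ∷ r) = 2 ℕ.+ sperAfter a r

vertical-edges : ∀ h b → b ≤ suc h → (h ∸ b) ℕ.+ (b ∸ h) ℕ.+ b ≡ h ℕ.+ 2 ℕ.* b2n (b ≡ᵇ suc h)
vertical-edges h             zero          _         = trans (ℕₚ.+-identityʳ _) (cong (ℕ._+_ h) (ℕₚ.0∸n≡0 h))
vertical-edges zero          (suc zero)    _         = refl
vertical-edges zero          (suc (suc b)) (s≤s ())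
vertical-edges (suc h)       (suc b)       (s≤s b≤h) = trans (ℕₚ.+-suc _ b) (cong suc (vertical-edges h b b≤h))

perimeterAfter-steps : ∀ c h r → stepsOK (h ∷ r) ≡ true →
  perimeterAfter c (h ∷ r) ≡ exposure c h ℕ.+ h ℕ.+ 3 ℕ.+ 2 ℕ.* sperAfter h r
perimeterAfter-steps c h []      ok = ends (exposure c h) h
  where
  ends : ∀ e h → e ℕ.+ suc h ℕ.+ 2 ℕ.+ 0 ≡ e ℕ.+ h ℕ.+ 3 ℕ.+ 2 ℕ.* 0
  ends = ℕ-Solver.solve-∀
perimeterAfter-steps c h (b ∷ r) ok = begin
  e ℕ.+ (h ∸ b) ℕ.+ 2 ℕ.+ perimeterAfter (just h) (b ∷ r)
    ≡⟨ cong (ℕ._+_ (e ℕ.+ (h ∸ b) ℕ.+ 2)) (perimeterAfter-steps (just h) b r (∧-conicalʳ _ _ ok)) ⟩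
  e ℕ.+ (h ∸ b) ℕ.+ 2 ℕ.+ ((b ∸ h) ℕ.+ b ℕ.+ 3 ℕ.+ 2 ℕ.* s)
    ≡⟨ regroup e (h ∸ b) (b ∸ h) b s ⟩
  e ℕ.+ ((h ∸ b) ℕ.+ (b ∸ h) ℕ.+ b) ℕ.+ 5 ℕ.+ 2 ℕ.* s
    ≡⟨ cong (λ x → e ℕ.+ x ℕ.+ 5 ℕ.+ 2 ℕ.* s) (vertical-edges h b (≤ᵇ⇒≤ b (suc h) (∧-conicalˡ _ _ ok))) ⟩
  e ℕ.+ (h ℕ.+ 2 ℕ.* δ) ℕ.+ 5 ℕ.+ 2 ℕ.* s
    ≡⟨ regroup′ e h δ s ⟩
  e ℕ.+ h ℕ.+ 3 ℕ.+ 2 ℕ.* suc (δ ℕ.+ s) ∎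
  where
  e s δ : ℕ
  e = exposure c h
  s = sperAfter b r
  δ = b2n (b ≡ᵇ suc h)
  regroup : ∀ e x y b s → e ℕ.+ x ℕ.+ 2 ℕ.+ (y ℕ.+ b ℕ.+ 3 ℕ.+ 2 ℕ.* s) ≡ e ℕ.+ (x ℕ.+ y ℕ.+ b) ℕ.+ 5 ℕ.+ 2 ℕ.* s
  regroup = ℕ-Solver.solve-∀
  regroup′ : ∀ e h δ s → e ℕ.+ (h ℕ.+ 2 ℕ.* δ) ℕ.+ 5 ℕ.+ 2 ℕ.* s ≡ e ℕ.+ h ℕ.+ 3 ℕ.+ 2 ℕ.* suc (δ ℕ.+ s)
  regroup′ = ℕ-Solver.solve-∀

perimeter-catalan : ∀ w → isCatalan w ≡ true → perimeter w ≡ semiperimeter w ℕ.* 2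
perimeter-catalan []          _   = refl
perimeter-catalan (zero ∷ r)  cat = begin
  perimeterFrom (0 ∷ r) 0 (0 ∷ r)          ≡⟨ perimeterFrom-drop (0 ∷ r) 0 (0 ∷ r) refl ⟩
  perimeterAfter nothing (0 ∷ r)           ≡⟨ perimeterAfter-steps nothing 0 r cat ⟩
  1 ℕ.+ 0 ℕ.+ 3 ℕ.+ 2 ℕ.* sperAfter 0 r    ≡⟨ double (sperAfter 0 r) ⟩
  (2 ℕ.+ sperAfter 0 r) ℕ.* 2              ∎
  where
  double : ∀ s → 1 ℕ.+ 0 ℕ.+ 3 ℕ.+ 2 ℕ.* s ≡ (2 ℕ.+ s) ℕ.* 2
  double = ℕ-Solver.solve-∀

sper-catalan : ∀ w → isCatalan w ≡ true → sper w ≡ semiperimeter w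
sper-catalan w cat = trans (cong (ℕ._/ 2) (perimeter-catalan w cat)) (m*n/n≡m (semiperimeter w) 2)

-- Avoiding Catalan words

-- validAfter p d r: the letters r may follow p, where d records whether p was reached by a weak descent
validAfter : ℕ → Bool → List ℕ → Bool
validAfter p d []      = true
validAfter p d (b ∷ r) = (b ≤ᵇ suc p) ∧ not (d ∧ (b ≤ᵇ p)) ∧ validAfter b (b ≤ᵇ p) r

valid : List ℕ → Bool
valid []      = true
valid (a ∷ r) = (a ≡ᵇ 0) ∧ validAfter a false r

stepsOK∧avoidsGeGe : ∀ q p r → stepsOK (p ∷ r) ∧ avoidsGeGe (q ∷ p ∷ r) ≡ validAfter p (p ≤ᵇ q) r
stepsOK∧avoidsGeGe q p []      = refl
stepsOK∧avoidsGeGe q p (b ∷ r) = begin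
  ((b ≤ᵇ suc p) ∧ stepsOK (b ∷ r)) ∧ (not ((p ≤ᵇ q) ∧ (b ≤ᵇ p)) ∧ avoidsGeGe (p ∷ b ∷ r))
    ≡⟨ interchange (b ≤ᵇ suc p) (stepsOK (b ∷ r)) (not ((p ≤ᵇ q) ∧ (b ≤ᵇ p))) (avoidsGeGe (p ∷ b ∷ r)) ⟩
  (b ≤ᵇ suc p) ∧ not ((p ≤ᵇ q) ∧ (b ≤ᵇ p)) ∧ (stepsOK (b ∷ r) ∧ avoidsGeGe (p ∷ b ∷ r))
    ≡⟨ cong (λ x → (b ≤ᵇ suc p) ∧ not ((p ≤ᵇ q) ∧ (b ≤ᵇ p)) ∧ x) (stepsOK∧avoidsGeGe p b r) ⟩
  validAfter p (p ≤ᵇ q) (b ∷ r) ∎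
  where
  interchange : ∀ x s y a → (x ∧ s) ∧ (y ∧ a) ≡ x ∧ y ∧ (s ∧ a)
  interchange false s y     a = refl
  interchange true  s false a = ∧-zeroʳ s
  interchange true  s true  a = refl

stepsOK∧avoidsGeGe-start : ∀ p r → stepsOK (p ∷ r) ∧ avoidsGeGe (p ∷ r) ≡ validAfter p false r
stepsOK∧avoidsGeGe-start p []      = refl
stepsOK∧avoidsGeGe-start p (b ∷ r) =
  trans (∧-assoc (b ≤ᵇ suc p) (stepsOK (b ∷ r)) (avoidsGeGe (p ∷ b ∷ r)))
        (cong ((b ≤ᵇ suc p) ∧_) (stepsOK∧avoidsGeGe p b r))

catalan∧avoiding≡valid : ∀ w → isCatalan w ∧ avoidsGeGe w ≡ valid w
catalan∧avoiding≡valid []      = refl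
catalan∧avoiding≡valid (a ∷ r) =
  trans (∧-assoc (a ≡ᵇ 0) (stepsOK (a ∷ r)) (avoidsGeGe (a ∷ r)))
        (cong ((a ≡ᵇ 0) ∧_) (stepsOK∧avoidsGeGe-start a r))

lastAfter : ℕ → List ℕ → ℕ
lastAfter p []      = p
lastAfter p (b ∷ r) = lastAfter b r

descentAfter : ℕ → Bool → List ℕ → Bool
descentAfter p d []      = d
descentAfter p d (b ∷ r) = descentAfter b (b ≤ᵇ p) r

validAfter-++ : ∀ p d xs ys →
  validAfter p d (xs ++ ys) ≡ validAfter p d xs ∧ validAfter (lastAfter p xs) (descentAfter p d xs) ys
validAfter-++ p d []       ys = refl
validAfter-++ p d (b ∷ xs) ys = begin
  (b ≤ᵇ suc p) ∧ not (d ∧ (b ≤ᵇ p)) ∧ validAfter b (b ≤ᵇ p) (xs ++ ys)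
    ≡⟨ cong (λ x → (b ≤ᵇ suc p) ∧ not (d ∧ (b ≤ᵇ p)) ∧ x) (validAfter-++ b (b ≤ᵇ p) xs ys) ⟩
  (b ≤ᵇ suc p) ∧ not (d ∧ (b ≤ᵇ p)) ∧ (validAfter b (b ≤ᵇ p) xs ∧ rest)
    ≡⟨ cong ((b ≤ᵇ suc p) ∧_) (sym (∧-assoc (not (d ∧ (b ≤ᵇ p))) _ _)) ⟩
  (b ≤ᵇ suc p) ∧ (not (d ∧ (b ≤ᵇ p)) ∧ validAfter b (b ≤ᵇ p) xs) ∧ rest
    ≡⟨ sym (∧-assoc (b ≤ᵇ suc p) _ _) ⟩
  validAfter p d (b ∷ xs) ∧ rest ∎
  where
  rest : Bool
  rest = validAfter (lastAfter b xs) (descentAfter b (b ≤ᵇ p) xs) ys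

sperAfter-++ : ∀ p xs ys → sperAfter p (xs ++ ys) ≡ sperAfter p xs ℕ.+ sperAfter (lastAfter p xs) ys
sperAfter-++ p []       ys = refl
sperAfter-++ p (b ∷ xs) ys = cong suc (trans (cong (ℕ._+_ (b2n (b ≡ᵇ suc p))) (sperAfter-++ b xs ys))
                                             (sym (ℕₚ.+-assoc (b2n (b ≡ᵇ suc p)) _ _)))

validAfter-map-suc : ∀ p d r → validAfter (suc p) d (map suc r) ≡ validAfter p d r
validAfter-map-suc p d []      = refl
validAfter-map-suc p d (b ∷ r) rewrite 1+m≤ᵇ1+n b (suc p) | 1+m≤ᵇ1+n b p =
  cong (λ x → (b ≤ᵇ suc p) ∧ not (d ∧ (b ≤ᵇ p)) ∧ x) (validAfter-map-suc b (b ≤ᵇ p) r)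

sperAfter-map-suc : ∀ p r → sperAfter (suc p) (map suc r) ≡ sperAfter p r
sperAfter-map-suc p []      = refl
sperAfter-map-suc p (b ∷ r) = cong (λ x → suc (b2n (b ≡ᵇ suc p) ℕ.+ x)) (sperAfter-map-suc b r)

validAfter-lift : ∀ d β → validAfter 0 d (map suc β) ≡ valid β
validAfter-lift d     []          = refl
validAfter-lift false (zero ∷ β)  = validAfter-map-suc 0 false β
validAfter-lift true  (zero ∷ β)  = validAfter-map-suc 0 false β
validAfter-lift d     (suc b ∷ β) = refl

sperAfter-lift : ∀ β → valid β ≡ true → sperAfter 0 (map suc β) ≡ semiperimeter β
sperAfter-lift []         _ = refl
sperAfter-lift (zero ∷ β) _ = cong (ℕ._+_ 2) (sperAfter-map-suc 0 β)

valid-lift : ∀ β → valid (0 ∷ map suc β) ≡ valid β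
valid-lift = validAfter-lift false

semiperimeter-lift : ∀ β → valid β ≡ true → semiperimeter (0 ∷ map suc β) ≡ 2 ℕ.+ semiperimeter β
semiperimeter-lift β ok = cong (ℕ._+_ 2) (sperAfter-lift β ok)

-- The only letter c after which a 0 may follow a Catalan word γ: the 0 must come after a strict ascent.
top : List ℕ → ℕ
top []      = 0
top (g ∷ γ) = suc (lastAfter g γ)

strict-ascent : ∀ c p d x → (c ≤ᵇ suc p) ∧ not (d ∧ (c ≤ᵇ p)) ∧ (not ((c ≤ᵇ p) ∧ true) ∧ x) ≡ (c ≡ᵇ suc p) ∧ x
strict-ascent zero          p       d     x = ∧-zeroʳ (not (d ∧ true))
strict-ascent (suc zero)    zero    false x = refl
strict-ascent (suc zero)    zero    true  x = refl
strict-ascent (suc (suc c)) zero    d     x = refl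
strict-ascent (suc c)       (suc p) d     x rewrite 1+m≤ᵇ1+n c (suc p) | 1+m≤ᵇ1+n c p = strict-ascent c p d x

valid-join : ∀ γ c β → valid (γ ++ c ∷ 0 ∷ map suc β) ≡ (valid γ ∧ (c ≡ᵇ top γ)) ∧ valid β
valid-join []      c β = cong ((c ≡ᵇ 0) ∧_) (validAfter-lift true β)
valid-join (g ∷ γ) c β = begin
  (g ≡ᵇ 0) ∧ validAfter g false (γ ++ c ∷ 0 ∷ map suc β)
    ≡⟨ cong ((g ≡ᵇ 0) ∧_) (validAfter-++ g false γ (c ∷ 0 ∷ map suc β)) ⟩
  (g ≡ᵇ 0) ∧ (validAfter g false γ ∧ validAfter p d (c ∷ 0 ∷ map suc β))
    ≡⟨ cong (λ x → (g ≡ᵇ 0) ∧ (validAfter g false γ ∧ x))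
            (trans (strict-ascent c p d _) (cong ((c ≡ᵇ suc p) ∧_) (validAfter-lift true β))) ⟩
  (g ≡ᵇ 0) ∧ (validAfter g false γ ∧ ((c ≡ᵇ suc p) ∧ valid β))
    ≡⟨ sym (∧-assoc (g ≡ᵇ 0) _ _) ⟩
  ((g ≡ᵇ 0) ∧ validAfter g false γ) ∧ ((c ≡ᵇ suc p) ∧ valid β)
    ≡⟨ sym (∧-assoc ((g ≡ᵇ 0) ∧ validAfter g false γ) _ _) ⟩
  (valid (g ∷ γ) ∧ (c ≡ᵇ top (g ∷ γ))) ∧ valid β ∎
  where
  p : ℕ
  p = lastAfter g γ
  d : Bool
  d = descentAfter g false γ

semiperimeter-join : ∀ γ β → valid β ≡ true →
  semiperimeter (γ ++ top γ ∷ 0 ∷ map suc β) ≡ 3 ℕ.+ (semiperimeter γ ℕ.+ semiperimeter β)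
semiperimeter-join []      β ok = cong (ℕ._+_ 3) (sperAfter-lift β ok)
semiperimeter-join (g ∷ γ) β ok = begin
  2 ℕ.+ sperAfter g (γ ++ suc p ∷ 0 ∷ map suc β)
    ≡⟨ cong (ℕ._+_ 2) (sperAfter-++ g γ (suc p ∷ 0 ∷ map suc β)) ⟩
  2 ℕ.+ (sperAfter g γ ℕ.+ suc (b2n (p ≡ᵇ p) ℕ.+ suc (sperAfter 0 (map suc β))))
    ≡⟨ cong₂ (λ x y → 2 ℕ.+ (sperAfter g γ ℕ.+ suc (b2n x ℕ.+ suc y))) (≡ᵇ-refl p) (sperAfter-lift β ok) ⟩
  2 ℕ.+ (sperAfter g γ ℕ.+ (3 ℕ.+ semiperimeter β))
    ≡⟨ regroup (sperAfter g γ) (semiperimeter β) ⟩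
  3 ℕ.+ ((2 ℕ.+ sperAfter g γ) ℕ.+ semiperimeter β) ∎
  where
  p : ℕ
  p = lastAfter g γ
  regroup : ∀ s t → 2 ℕ.+ (s ℕ.+ (3 ℕ.+ t)) ≡ 3 ℕ.+ ((2 ℕ.+ s) ℕ.+ t)
  regroup = ℕ-Solver.solve-∀

validAfter-head : ∀ p d b r → validAfter p d (b ∷ r) ≡ true → b ≤ suc p
validAfter-head p d b r ok = ≤ᵇ⇒≤ b (suc p) (∧-conicalˡ _ _ ok)

validAfter-tail : ∀ p d b r → validAfter p d (b ∷ r) ≡ true → validAfter b (b ≤ᵇ p) r ≡ true
validAfter-tail p d b r ok = ∧-conicalʳ (not (d ∧ (b ≤ᵇ p))) _ (∧-conicalʳ (b ≤ᵇ suc p) _ ok)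

validAfter-letters : ∀ p d r {m} → validAfter p d r ≡ true → m ∈ r → m ≤ length r ℕ.+ p
validAfter-letters p d (b ∷ r) ok (here refl) =
  ℕₚ.≤-trans (validAfter-head p d b r ok) (s≤s (ℕₚ.m≤n+m p (length r)))
validAfter-letters p d (b ∷ r) ok (there m∈r) =
  ℕₚ.≤-trans (validAfter-letters b (b ≤ᵇ p) r (validAfter-tail p d b r ok) m∈r)
    (ℕₚ.≤-trans (ℕₚ.+-monoʳ-≤ (length r) (validAfter-head p d b r ok))
                (ℕₚ.≤-reflexive (ℕₚ.+-suc (length r) p)))

validAfter-last : ∀ p d r → validAfter p d r ≡ true → lastAfter p r ≤ length r ℕ.+ p
validAfter-last p d []      ok = ℕₚ.≤-refl
validAfter-last p d (b ∷ r) ok =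
  ℕₚ.≤-trans (validAfter-last b (b ≤ᵇ p) r (validAfter-tail p d b r ok))
    (ℕₚ.≤-trans (ℕₚ.+-monoʳ-≤ (length r) (validAfter-head p d b r ok))
                (ℕₚ.≤-reflexive (ℕₚ.+-suc (length r) p)))

valid-letters : ∀ w {m} → valid w ≡ true → m ∈ w → m < length w
valid-letters (zero ∷ r) ok (here refl)  = s≤s z≤n
valid-letters (zero ∷ r) ok (there m∈r) =
  s≤s (ℕₚ.≤-trans (validAfter-letters 0 false r ok m∈r) (ℕₚ.≤-reflexive (ℕₚ.+-identityʳ (length r))))

top-bound : ∀ γ → valid γ ≡ true → top γ ≤ length γ
top-bound []         ok = z≤n
top-bound (zero ∷ γ) ok = s≤s (ℕₚ.≤-trans (validAfter-last 0 false γ ok) (ℕₚ.≤-reflexive (ℕₚ.+-identityʳ (length γ))))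

-- Counting

∑-allLists-suc : ∀ n m (f : List ℕ → ℤ) →
  ∑ (allLists (suc n) m) f ≡ ∑[ a < m ] ∑[ w ∈ allLists n m ] f (a ∷ w)
∑-allLists-suc n m f = trans (∑-concatMap (λ a → map (a ∷_) (allLists n m)) (upTo m) f)
                             (∑-cong (upTo m) (λ a → ∑-map (a ∷_) (allLists n m) f))

∑-allLists-cong : ∀ n m {f g : List ℕ → ℤ} → (∀ w → length w ≡ n → f w ≡ g w) →
  ∑ (allLists n m) f ≡ ∑ (allLists n m) g
∑-allLists-cong zero    m f≡g = cong (_+ + 0) (f≡g [] refl)
∑-allLists-cong (suc n) m {f} {g} f≡g = begin
  ∑ (allLists (suc n) m) f                    ≡⟨ ∑-allLists-suc n m f ⟩
  ∑[ a < m ] ∑[ w ∈ allLists n m ] f (a ∷ w)  ≡⟨ ∑-cong (upTo m) (λ a → ∑-allLists-cong n m (λ w ∣w∣ → f≡g (a ∷ w) (cong suc ∣w∣))) ⟩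
  ∑[ a < m ] ∑[ w ∈ allLists n m ] g (a ∷ w)  ≡⟨ sym (∑-allLists-suc n m g) ⟩
  ∑ (allLists (suc n) m) g                    ∎

∑-allLists-++ : ∀ i j m (f : List ℕ → ℤ) →
  ∑ (allLists (i ℕ.+ j) m) f ≡ ∑[ u ∈ allLists i m ] ∑[ v ∈ allLists j m ] f (u ++ v)
∑-allLists-++ zero    j m f = sym (ℤₚ.+-identityʳ _)
∑-allLists-++ (suc i) j m f = begin
  ∑ (allLists (suc (i ℕ.+ j)) m) f
    ≡⟨ ∑-allLists-suc (i ℕ.+ j) m f ⟩
  ∑[ a < m ] ∑[ w ∈ allLists (i ℕ.+ j) m ] f (a ∷ w)
    ≡⟨ ∑-cong (upTo m) (λ a → ∑-allLists-++ i j m (f ∘ (a ∷_))) ⟩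
  ∑[ a < m ] ∑[ u ∈ allLists i m ] ∑[ v ∈ allLists j m ] f (a ∷ u ++ v)
    ≡⟨ sym (∑-allLists-suc i m (λ u → ∑[ v ∈ allLists j m ] f (u ++ v))) ⟩
  ∑[ u ∈ allLists (suc i) m ] ∑[ v ∈ allLists j m ] f (u ++ v) ∎

∑-allLists-unused : ∀ n m (f : List ℕ → ℤ) → (∀ w → length w ≡ n → m ∈ w → f w ≡ + 0) →
  ∑ (allLists n (suc m)) f ≡ ∑ (allLists n m) f
∑-allLists-unused zero    m f unused = refl
∑-allLists-unused (suc n) m f unused = begin
  ∑ (allLists (suc n) (suc m)) f
    ≡⟨ ∑-allLists-suc n (suc m) f ⟩
  ∑[ a < suc m ] ∑[ w ∈ allLists n (suc m) ] f (a ∷ w)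
    ≡⟨ ∑<-snoc m (λ a → ∑[ w ∈ allLists n (suc m) ] f (a ∷ w)) ⟩
  (∑[ a < m ] ∑[ w ∈ allLists n (suc m) ] f (a ∷ w)) + (∑[ w ∈ allLists n (suc m) ] f (m ∷ w))
    ≡⟨ cong₂ _+_ (∑-cong (upTo m) (λ a → ∑-allLists-unused n m (f ∘ (a ∷_))
                                          (λ w ∣w∣ m∈w → unused (a ∷ w) (cong suc ∣w∣) (there m∈w))))
                 (trans (∑-allLists-cong n (suc m) (λ w ∣w∣ → unused (m ∷ w) (cong suc ∣w∣) (here refl)))
                        (∑-zero (allLists n (suc m)) (λ _ → refl))) ⟩
  (∑[ a < m ] ∑[ w ∈ allLists n m ] f (a ∷ w)) + + 0
    ≡⟨ ℤₚ.+-identityʳ _ ⟩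
  ∑[ a < m ] ∑[ w ∈ allLists n m ] f (a ∷ w)
    ≡⟨ sym (∑-allLists-suc n m f) ⟩
  ∑ (allLists (suc n) m) f ∎

weight : ℕ → List ℕ → ℤ
weight k w = ⟦ valid w ∧ (semiperimeter w ≡ᵇ k) ⟧

W : Series
W n k = ∑[ w ∈ allLists n n ] weight k w

weight-invalid : ∀ k w → valid w ≡ false → weight k w ≡ + 0
weight-invalid k w invalid = cong (λ v → ⟦ v ∧ (semiperimeter w ≡ᵇ k) ⟧) invalid

weight-letters : ∀ k w {m} → length w ≤ m → m ∈ w → weight k w ≡ + 0
weight-letters k w ∣w∣≤m m∈w with valid w in ok
... | false = refl
... | true  = ⊥-elim (ℕₚ.<⇒≱ (valid-letters w ok m∈w) ∣w∣≤m)

W-alphabet : ∀ n m k → n ≤ m → ∑[ w ∈ allLists n m ] weight k w ≡ W n k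
W-alphabet n m k n≤m = subst (λ M → ∑ (allLists n M) (weight k) ≡ W n k) (ℕₚ.m∸n+n≡m n≤m) (extend (m ∸ n))
  where
  extend : ∀ d → ∑ (allLists n (d ℕ.+ n)) (weight k) ≡ W n k
  extend zero    = refl
  extend (suc d) = trans (∑-allLists-unused n (d ℕ.+ n) (weight k)
                            (λ w ∣w∣ → weight-letters k w (ℕₚ.≤-trans (ℕₚ.≤-reflexive ∣w∣) (ℕₚ.m≤n+m n d))))
                         (extend d)

startsLastZero : List ℕ → Bool
startsLastZero []      = false
startsLastZero (a ∷ v) = (a ≡ᵇ 0) ∧ not (any (_≡ᵇ 0) v)

∑-startsLastZero : ∀ w → ∑[ i < length w ] ⟦ startsLastZero (drop i w) ⟧ ≡ ⟦ any (_≡ᵇ 0) w ⟧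
∑-startsLastZero []      = refl
∑-startsLastZero (a ∷ w) = begin
  ∑[ i < suc (length w) ] ⟦ startsLastZero (drop i (a ∷ w)) ⟧
    ≡⟨ ∑<-suc (length w) (λ i → ⟦ startsLastZero (drop i (a ∷ w)) ⟧) ⟩
  ⟦ (a ≡ᵇ 0) ∧ not (any (_≡ᵇ 0) w) ⟧ + (∑[ i < length w ] ⟦ startsLastZero (drop i w) ⟧)
    ≡⟨ cong (_+_ ⟦ (a ≡ᵇ 0) ∧ not (any (_≡ᵇ 0) w) ⟧) (∑-startsLastZero w) ⟩
  ⟦ (a ≡ᵇ 0) ∧ not (any (_≡ᵇ 0) w) ⟧ + ⟦ any (_≡ᵇ 0) w ⟧
    ≡⟨ here-or-later (a ≡ᵇ 0) (any (_≡ᵇ 0) w) ⟩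
  ⟦ (a ≡ᵇ 0) ∨ any (_≡ᵇ 0) w ⟧ ∎
  where
  here-or-later : ∀ x y → ⟦ x ∧ not y ⟧ + ⟦ y ⟧ ≡ ⟦ x ∨ y ⟧
  here-or-later true  true  = refl
  here-or-later true  false = refl
  here-or-later false true  = refl
  here-or-later false false = refl

weight-by-lastZero : ∀ n k w → length w ≡ suc n →
  weight k w ≡ ∑[ i < suc n ] weight k w * ⟦ startsLastZero (drop i w) ⟧
weight-by-lastZero n k (a ∷ w) ∣w∣ = begin
  weight k (a ∷ w)
    ≡⟨ has-zero a ⟩
  weight k (a ∷ w) * ⟦ any (_≡ᵇ 0) (a ∷ w) ⟧
    ≡⟨ cong (weight k (a ∷ w) *_) (sym (∑-startsLastZero (a ∷ w))) ⟩
  weight k (a ∷ w) * (∑[ i < suc (length w) ] ⟦ startsLastZero (drop i (a ∷ w)) ⟧)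
    ≡⟨ *-distribˡ-∑ (weight k (a ∷ w)) (upTo (suc (length w))) _ ⟩
  ∑[ i < suc (length w) ] weight k (a ∷ w) * ⟦ startsLastZero (drop i (a ∷ w)) ⟧
    ≡⟨ cong (λ l → ∑[ i < l ] weight k (a ∷ w) * ⟦ startsLastZero (drop i (a ∷ w)) ⟧) ∣w∣ ⟩
  ∑[ i < suc n ] weight k (a ∷ w) * ⟦ startsLastZero (drop i (a ∷ w)) ⟧ ∎
  where
  has-zero : ∀ a → weight k (a ∷ w) ≡ weight k (a ∷ w) * ⟦ any (_≡ᵇ 0) (a ∷ w) ⟧
  has-zero zero    = sym (ℤₚ.*-identityʳ (weight k (0 ∷ w)))
  has-zero (suc a) = refl

∑-zeroFree : ∀ r m (g : List ℕ → ℤ) →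
  ∑[ v ∈ allLists r (suc m) ] g v * ⟦ not (any (_≡ᵇ 0) v) ⟧ ≡ ∑[ β ∈ allLists r m ] g (map suc β)
∑-zeroFree zero    m g = cong (_+ + 0) (ℤₚ.*-identityʳ (g []))
∑-zeroFree (suc r) m g = begin
  ∑[ v ∈ allLists (suc r) (suc m) ] g v * ⟦ not (any (_≡ᵇ 0) v) ⟧
    ≡⟨ ∑-allLists-suc r (suc m) (λ v → g v * ⟦ not (any (_≡ᵇ 0) v) ⟧) ⟩
  ∑[ a < suc m ] ∑[ v ∈ allLists r (suc m) ] g (a ∷ v) * ⟦ not ((a ≡ᵇ 0) ∨ any (_≡ᵇ 0) v) ⟧
    ≡⟨ ∑<-suc m (λ a → ∑[ v ∈ allLists r (suc m) ] g (a ∷ v) * ⟦ not ((a ≡ᵇ 0) ∨ any (_≡ᵇ 0) v) ⟧) ⟩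
  (∑[ v ∈ allLists r (suc m) ] g (0 ∷ v) * + 0)
    + (∑[ a < m ] ∑[ v ∈ allLists r (suc m) ] g (suc a ∷ v) * ⟦ not (any (_≡ᵇ 0) v) ⟧)
    ≡⟨ cong₂ _+_ (∑-zero (allLists r (suc m)) (λ v → ℤₚ.*-zeroʳ (g (0 ∷ v))))
                 (∑-cong (upTo m) (λ a → ∑-zeroFree r m (g ∘ (suc a ∷_)))) ⟩
  + 0 + (∑[ a < m ] ∑[ β ∈ allLists r m ] g (suc a ∷ map suc β))
    ≡⟨ ℤₚ.+-identityˡ _ ⟩
  ∑[ a < m ] ∑[ β ∈ allLists r m ] g (map suc (a ∷ β))
    ≡⟨ sym (∑-allLists-suc r m (g ∘ map suc)) ⟩
  ∑[ β ∈ allLists (suc r) m ] g (map suc β) ∎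

∑-lastZero-suffix : ∀ r m (f : List ℕ → ℤ) →
  ∑[ v ∈ allLists (suc r) (suc m) ] f v * ⟦ startsLastZero v ⟧ ≡ ∑[ β ∈ allLists r m ] f (0 ∷ map suc β)
∑-lastZero-suffix r m f = begin
  ∑[ v ∈ allLists (suc r) (suc m) ] f v * ⟦ startsLastZero v ⟧
    ≡⟨ ∑-allLists-suc r (suc m) (λ v → f v * ⟦ startsLastZero v ⟧) ⟩
  ∑[ a < suc m ] ∑[ v ∈ allLists r (suc m) ] f (a ∷ v) * ⟦ startsLastZero (a ∷ v) ⟧
    ≡⟨ ∑<-suc m (λ a → ∑[ v ∈ allLists r (suc m) ] f (a ∷ v) * ⟦ startsLastZero (a ∷ v) ⟧) ⟩
  (∑[ v ∈ allLists r (suc m) ] f (0 ∷ v) * ⟦ not (any (_≡ᵇ 0) v) ⟧)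
    + (∑[ a < m ] ∑[ v ∈ allLists r (suc m) ] f (suc a ∷ v) * + 0)
    ≡⟨ cong₂ _+_ (∑-zeroFree r m (f ∘ (0 ∷_)))
                 (∑-zero (upTo m) (λ a → ∑-zero (allLists r (suc m)) (λ v → ℤₚ.*-zeroʳ (f (suc a ∷ v))))) ⟩
  (∑[ β ∈ allLists r m ] f (0 ∷ map suc β)) + + 0
    ≡⟨ ℤₚ.+-identityʳ _ ⟩
  ∑[ β ∈ allLists r m ] f (0 ∷ map suc β) ∎

drop-++ : ∀ (u v : List ℕ) → drop (length u) (u ++ v) ≡ v
drop-++ []      v = refl
drop-++ (a ∷ u) v = drop-++ u v

W-lastZero : ∀ n k →
  W (suc n) k ≡ ∑[ i < suc n ] ∑[ u ∈ allLists i (suc n) ] ∑[ β ∈ allLists (n ∸ i) n ] weight k (u ++ 0 ∷ map suc β)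
W-lastZero n k = begin
  ∑[ w ∈ allLists (suc n) (suc n) ] weight k w
    ≡⟨ ∑-allLists-cong (suc n) (suc n) (weight-by-lastZero n k) ⟩
  ∑[ w ∈ allLists (suc n) (suc n) ] ∑[ i < suc n ] weight k w * ⟦ startsLastZero (drop i w) ⟧
    ≡⟨ ∑-comm (allLists (suc n) (suc n)) (upTo (suc n)) (λ w i → weight k w * ⟦ startsLastZero (drop i w) ⟧) ⟩
  ∑[ i < suc n ] ∑[ w ∈ allLists (suc n) (suc n) ] weight k w * ⟦ startsLastZero (drop i w) ⟧
    ≡⟨ ∑<-cong-< (suc n) (λ i i<1+n → split-at i (ℕₚ.≤-pred i<1+n)) ⟩
  ∑[ i < suc n ] ∑[ u ∈ allLists i (suc n) ] ∑[ β ∈ allLists (n ∸ i) n ] weight k (u ++ 0 ∷ map suc β) ∎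
  where
  split-at : ∀ i → i ≤ n →
    ∑[ w ∈ allLists (suc n) (suc n) ] weight k w * ⟦ startsLastZero (drop i w) ⟧
      ≡ ∑[ u ∈ allLists i (suc n) ] ∑[ β ∈ allLists (n ∸ i) n ] weight k (u ++ 0 ∷ map suc β)
  split-at i i≤n = begin
    ∑[ w ∈ allLists (suc n) (suc n) ] weight k w * ⟦ startsLastZero (drop i w) ⟧
      ≡⟨ cong (λ l → ∑[ w ∈ allLists l (suc n) ] weight k w * ⟦ startsLastZero (drop i w) ⟧) (sym ∣w∣) ⟩
    ∑[ w ∈ allLists (i ℕ.+ suc (n ∸ i)) (suc n) ] weight k w * ⟦ startsLastZero (drop i w) ⟧
      ≡⟨ ∑-allLists-++ i (suc (n ∸ i)) (suc n) (λ w → weight k w * ⟦ startsLastZero (drop i w) ⟧) ⟩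
    ∑[ u ∈ allLists i (suc n) ] ∑[ v ∈ allLists (suc (n ∸ i)) (suc n) ] weight k (u ++ v) * ⟦ startsLastZero (drop i (u ++ v)) ⟧
      ≡⟨ ∑-allLists-cong i (suc n) (λ u ∣u∣ → ∑-cong (allLists (suc (n ∸ i)) (suc n)) (λ v →
           cong (λ d → weight k (u ++ v) * ⟦ startsLastZero d ⟧) (trans (cong (λ l → drop l (u ++ v)) (sym ∣u∣)) (drop-++ u v)))) ⟩
    ∑[ u ∈ allLists i (suc n) ] ∑[ v ∈ allLists (suc (n ∸ i)) (suc n) ] weight k (u ++ v) * ⟦ startsLastZero v ⟧
      ≡⟨ ∑-cong (allLists i (suc n)) (λ u → ∑-lastZero-suffix (n ∸ i) n (weight k ∘ (u ++_))) ⟩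
    ∑[ u ∈ allLists i (suc n) ] ∑[ β ∈ allLists (n ∸ i) n ] weight k (u ++ 0 ∷ map suc β) ∎
    where
    ∣w∣ : i ℕ.+ suc (n ∸ i) ≡ suc n
    ∣w∣ = trans (ℕₚ.+-suc i (n ∸ i)) (cong suc (ℕₚ.m+[n∸m]≡n i≤n))

⟦⟧-∧-+≡ᵇ : ∀ x a s k → ⟦ x ∧ (a ℕ.+ s ≡ᵇ k) ⟧ ≡ delay a (λ k′ → ⟦ x ∧ (s ≡ᵇ k′) ⟧) k
⟦⟧-∧-+≡ᵇ x zero    s k       = refl
⟦⟧-∧-+≡ᵇ x (suc a) s zero    = cong ⟦_⟧ (∧-zeroʳ x)
⟦⟧-∧-+≡ᵇ x (suc a) s (suc k) = ⟦⟧-∧-+≡ᵇ x a s k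

weight-lift : ∀ k β → weight k (0 ∷ map suc β) ≡ delay 2 (λ k′ → weight k′ β) k
weight-lift k β = begin
  ⟦ valid (0 ∷ map suc β) ∧ (semiperimeter (0 ∷ map suc β) ≡ᵇ k) ⟧
    ≡⟨ cong (λ v → ⟦ v ∧ (semiperimeter (0 ∷ map suc β) ≡ᵇ k) ⟧) (valid-lift β) ⟩
  ⟦ valid β ∧ (semiperimeter (0 ∷ map suc β) ≡ᵇ k) ⟧
    ≡⟨ cong ⟦_⟧ (guarded (valid β) (λ okβ → cong (_≡ᵇ k) (semiperimeter-lift β okβ))) ⟩
  ⟦ valid β ∧ (2 ℕ.+ semiperimeter β ≡ᵇ k) ⟧
    ≡⟨ ⟦⟧-∧-+≡ᵇ (valid β) 2 (semiperimeter β) k ⟩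
  delay 2 (λ k′ → weight k′ β) k ∎

weight-join : ∀ k γ β → valid γ ≡ true →
  weight k (γ ++ top γ ∷ 0 ∷ map suc β) ≡ ⟦ valid β ∧ (3 ℕ.+ (semiperimeter γ ℕ.+ semiperimeter β) ≡ᵇ k) ⟧
weight-join k γ β okγ = cong ⟦_⟧ (begin
  valid w ∧ (semiperimeter w ≡ᵇ k)
    ≡⟨ cong (_∧ (semiperimeter w ≡ᵇ k))
            (trans (valid-join γ (top γ) β) (cong₂ (λ x y → (x ∧ y) ∧ valid β) okγ (≡ᵇ-refl (top γ)))) ⟩
  valid β ∧ (semiperimeter w ≡ᵇ k)
    ≡⟨ guarded (valid β) (λ okβ → cong (_≡ᵇ k) (semiperimeter-join γ β okβ)) ⟩
  valid β ∧ (3 ℕ.+ (semiperimeter γ ℕ.+ semiperimeter β) ≡ᵇ k) ∎)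
  where
  w : List ℕ
  w = γ ++ top γ ∷ 0 ∷ map suc β

∑-join : ∀ k γ β M → length γ < M →
  ∑[ c < M ] weight k (γ ++ c ∷ 0 ∷ map suc β)
    ≡ ⟦ (valid γ ∧ valid β) ∧ (3 ℕ.+ (semiperimeter γ ℕ.+ semiperimeter β) ≡ᵇ k) ⟧
∑-join k γ β M ∣γ∣<M with valid γ in okγ
... | false = ∑-zero (upTo M) (λ c → weight-invalid k (γ ++ c ∷ 0 ∷ map suc β)
                (trans (valid-join γ c β) (cong (λ x → (x ∧ (c ≡ᵇ top γ)) ∧ valid β) okγ)))
... | true  = trans (∑<-pick M (top γ) (ℕₚ.≤-<-trans (top-bound γ okγ) ∣γ∣<M)
                      (λ c c≢top → weight-invalid k (γ ++ c ∷ 0 ∷ map suc β)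
                         (trans (valid-join γ c β) (cong₂ (λ x y → (x ∧ y) ∧ valid β) okγ c≢top))))
                    (weight-join k γ β okγ)

convolution-weights : ∀ γ β h →
  ∑[ j < suc h ] weight j γ * weight (h ∸ j) β ≡ ⟦ (valid γ ∧ valid β) ∧ (semiperimeter γ ℕ.+ semiperimeter β ≡ᵇ h) ⟧
convolution-weights γ β h = begin
  ∑[ j < suc h ] weight j γ * weight (h ∸ j) β
    ≡⟨ ∑-cong (upTo (suc h)) (λ j → factor (valid γ) (valid β) (sγ ≡ᵇ j) (sβ ≡ᵇ h ∸ j)) ⟩
  ∑[ j < suc h ] ⟦ valid γ ∧ valid β ⟧ * (⟦ sγ ≡ᵇ j ⟧ * ⟦ sβ ≡ᵇ h ∸ j ⟧)
    ≡⟨ sym (*-distribˡ-∑ ⟦ valid γ ∧ valid β ⟧ (upTo (suc h)) (λ j → ⟦ sγ ≡ᵇ j ⟧ * ⟦ sβ ≡ᵇ h ∸ j ⟧)) ⟩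
  ⟦ valid γ ∧ valid β ⟧ * (∑[ j < suc h ] ⟦ sγ ≡ᵇ j ⟧ * ⟦ sβ ≡ᵇ h ∸ j ⟧)
    ≡⟨ cong (⟦ valid γ ∧ valid β ⟧ *_) (sym (⟦⟧-+≡ᵇ sγ sβ h)) ⟩
  ⟦ valid γ ∧ valid β ⟧ * ⟦ sγ ℕ.+ sβ ≡ᵇ h ⟧
    ≡⟨ sym (⟦⟧-∧ (valid γ ∧ valid β) (sγ ℕ.+ sβ ≡ᵇ h)) ⟩
  ⟦ (valid γ ∧ valid β) ∧ (sγ ℕ.+ sβ ≡ᵇ h) ⟧ ∎
  where
  sγ sβ : ℕ
  sγ = semiperimeter γ
  sβ = semiperimeter β
  factor : ∀ x y a b → ⟦ x ∧ a ⟧ * ⟦ y ∧ b ⟧ ≡ ⟦ x ∧ y ⟧ * (⟦ a ⟧ * ⟦ b ⟧)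
  factor true  true  a b = sym (ℤₚ.*-identityˡ (⟦ a ⟧ * ⟦ b ⟧))
  factor true  false a b = ℤₚ.*-zeroʳ ⟦ a ⟧
  factor false y     a b = refl

W-recurrence : ∀ n k →
  W (suc n) k ≡ delay 2 (W n) k + (∑[ i < n ] delay 3 (λ h → ∑[ j < suc h ] W i j * W (n ∸ suc i) (h ∸ j)) k)
W-recurrence n k = begin
  W (suc n) k                        ≡⟨ W-lastZero n k ⟩
  ∑[ i < suc n ] term i              ≡⟨ ∑<-suc n term ⟩
  term 0 + (∑[ i < n ] term (suc i)) ≡⟨ cong₂ _+_ no-prefix (∑<-cong-< n prefix) ⟩
  delay 2 (W n) k + (∑[ i < n ] delay 3 (λ h → ∑[ j < suc h ] W i j * W (n ∸ suc i) (h ∸ j)) k) ∎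
  where
  term : ℕ → ℤ
  term i = ∑[ u ∈ allLists i (suc n) ] ∑[ β ∈ allLists (n ∸ i) n ] weight k (u ++ 0 ∷ map suc β)

  no-prefix : term 0 ≡ delay 2 (W n) k
  no-prefix = begin
    (∑[ β ∈ allLists n n ] weight k (0 ∷ map suc β)) + + 0
      ≡⟨ ℤₚ.+-identityʳ _ ⟩
    ∑[ β ∈ allLists n n ] weight k (0 ∷ map suc β)
      ≡⟨ ∑-cong (allLists n n) (weight-lift k) ⟩
    ∑[ β ∈ allLists n n ] delay 2 (λ k′ → weight k′ β) k
      ≡⟨ sym (delay-∑ 2 (allLists n n) weight k) ⟩
    delay 2 (W n) k ∎

  prefix : ∀ i → i < n → term (suc i) ≡ delay 3 (λ h → ∑[ j < suc h ] W i j * W (n ∸ suc i) (h ∸ j)) k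
  prefix i i<n = begin
    ∑[ u ∈ allLists (suc i) (suc n) ] G u
      ≡⟨ cong (λ l → ∑ (allLists l (suc n)) G) (ℕₚ.+-comm 1 i) ⟩
    ∑[ u ∈ allLists (i ℕ.+ 1) (suc n) ] G u
      ≡⟨ ∑-allLists-++ i 1 (suc n) G ⟩
    ∑[ γ ∈ Γs ] ∑[ x ∈ allLists 1 (suc n) ] G (γ ++ x)
      ≡⟨ ∑-allLists-cong i (suc n) last-letter ⟩
    ∑[ γ ∈ Γs ] ∑[ β ∈ Bs ] delay 3 (λ h → ∑[ j < suc h ] weight j γ * weight (h ∸ j) β) k
      ≡⟨ ∑-cong Γs (λ γ → sym (delay-∑ 3 Bs (λ h β → ∑[ j < suc h ] weight j γ * weight (h ∸ j) β) k)) ⟩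
    ∑[ γ ∈ Γs ] delay 3 (λ h → ∑[ β ∈ Bs ] ∑[ j < suc h ] weight j γ * weight (h ∸ j) β) k
      ≡⟨ sym (delay-∑ 3 Γs (λ h γ → ∑[ β ∈ Bs ] ∑[ j < suc h ] weight j γ * weight (h ∸ j) β) k) ⟩
    delay 3 (λ h → ∑[ γ ∈ Γs ] ∑[ β ∈ Bs ] ∑[ j < suc h ] weight j γ * weight (h ∸ j) β) k
      ≡⟨ delay-cong 3 (λ h → ∑-convolution Γs Bs h weight weight) k ⟩
    delay 3 (λ h → ∑[ j < suc h ] (∑[ γ ∈ Γs ] weight j γ) * (∑[ β ∈ Bs ] weight (h ∸ j) β)) k
      ≡⟨ delay-cong 3 (λ h → ∑-cong (upTo (suc h)) (λ j →
           cong₂ _*_ (W-alphabet i (suc n) j (ℕₚ.≤-trans (ℕₚ.<⇒≤ i<n) (ℕₚ.n≤1+n n)))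
                     (W-alphabet (n ∸ suc i) n (h ∸ j) (ℕₚ.m∸n≤m n (suc i))))) k ⟩
    delay 3 (λ h → ∑[ j < suc h ] W i j * W (n ∸ suc i) (h ∸ j)) k ∎
    where
    Γs Bs : List (List ℕ)
    Γs = allLists i (suc n)
    Bs = allLists (n ∸ suc i) n
    G : List ℕ → ℤ
    G u = ∑[ β ∈ Bs ] weight k (u ++ 0 ∷ map suc β)

    last-letter : ∀ γ → length γ ≡ i →
      ∑[ x ∈ allLists 1 (suc n) ] G (γ ++ x) ≡ ∑[ β ∈ Bs ] delay 3 (λ h → ∑[ j < suc h ] weight j γ * weight (h ∸ j) β) k
    last-letter γ ∣γ∣ = begin
      ∑[ x ∈ allLists 1 (suc n) ] G (γ ++ x)
        ≡⟨ ∑-allLists-suc 0 (suc n) (G ∘ (γ ++_)) ⟩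
      ∑[ c < suc n ] (G (γ ++ c ∷ []) + + 0)
        ≡⟨ ∑-cong (upTo (suc n)) (λ c → trans (ℤₚ.+-identityʳ _)
             (∑-cong Bs (λ β → cong (weight k) (Listₚ.++-assoc γ (c ∷ []) (0 ∷ map suc β))))) ⟩
      ∑[ c < suc n ] ∑[ β ∈ Bs ] weight k (γ ++ c ∷ 0 ∷ map suc β)
        ≡⟨ ∑-comm (upTo (suc n)) Bs (λ c β → weight k (γ ++ c ∷ 0 ∷ map suc β)) ⟩
      ∑[ β ∈ Bs ] ∑[ c < suc n ] weight k (γ ++ c ∷ 0 ∷ map suc β)
        ≡⟨ ∑-cong Bs joined ⟩
      ∑[ β ∈ Bs ] delay 3 (λ h → ∑[ j < suc h ] weight j γ * weight (h ∸ j) β) k ∎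
      where
      joined : ∀ β → ∑[ c < suc n ] weight k (γ ++ c ∷ 0 ∷ map suc β)
                     ≡ delay 3 (λ h → ∑[ j < suc h ] weight j γ * weight (h ∸ j) β) k
      joined β = begin
        ∑[ c < suc n ] weight k (γ ++ c ∷ 0 ∷ map suc β)
          ≡⟨ ∑-join k γ β (suc n) (ℕₚ.<-trans (ℕₚ.≤-reflexive (cong suc ∣γ∣)) (s≤s i<n)) ⟩
        ⟦ (valid γ ∧ valid β) ∧ (3 ℕ.+ (semiperimeter γ ℕ.+ semiperimeter β) ≡ᵇ k) ⟧
          ≡⟨ ⟦⟧-∧-+≡ᵇ (valid γ ∧ valid β) 3 (semiperimeter γ ℕ.+ semiperimeter β) k ⟩
        delay 3 (λ h → ⟦ (valid γ ∧ valid β) ∧ (semiperimeter γ ℕ.+ semiperimeter β ≡ᵇ h) ⟧) k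
          ≡⟨ delay-cong 3 (λ h → sym (convolution-weights γ β h)) k ⟩
        delay 3 (λ h → ∑[ j < suc h ] weight j γ * weight (h ∸ j) β) k ∎

W-equation : W ≈ₛ ((𝟏 ⊕ shift 1 2 W) ⊕ shift 2 3 (W ⊛ W))
W-equation zero    zero    = refl
W-equation zero    (suc k) = refl
W-equation (suc n) k = begin
  W (suc n) k
    ≡⟨ W-recurrence n k ⟩
  delay 2 (W n) k + (∑[ i < n ] delay 3 (λ h → ∑[ j < suc h ] W i j * W (n ∸ suc i) (h ∸ j)) k)
    ≡⟨ cong₂ _+_ (sym (ℤₚ.+-identityˡ (delay 2 (W n) k))) (pairs n) ⟩
  (+ 0 + delay 2 (W n) k) + delay 1 (λ m → delay 3 ((W ⊛ W) m) k) n ∎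
  where
  pairs : ∀ n → ∑[ i < n ] delay 3 (λ h → ∑[ j < suc h ] W i j * W (n ∸ suc i) (h ∸ j)) k
              ≡ delay 1 (λ m → delay 3 ((W ⊛ W) m) k) n
  pairs zero    = refl
  pairs (suc m) = sym (delay-∑ 3 (upTo (suc m)) (λ h i → ∑[ j < suc h ] W i j * W (m ∸ i) (h ∸ j)) k)

filters≡weight : ∀ k w → ⟦ does (isCatalan w ∧ avoidsGeGe w Boolₚ.≟ true) ⟧ * (⟦ does (sper w ℕ.≟ k) ⟧ * + 1) ≡ weight k w
filters≡weight k w with isCatalan w ∧ avoidsGeGe w in ok
... | false = sym (weight-invalid k w (trans (sym (catalan∧avoiding≡valid w)) ok))
... | true  = begin
  + 1 * (⟦ sper w ≡ᵇ k ⟧ * + 1)                ≡⟨ trans (ℤₚ.*-identityˡ _) (ℤₚ.*-identityʳ _) ⟩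
  ⟦ sper w ≡ᵇ k ⟧                              ≡⟨ cong (λ s → ⟦ s ≡ᵇ k ⟧) (sper-catalan w (∧-conicalˡ _ _ ok)) ⟩
  ⟦ semiperimeter w ≡ᵇ k ⟧                     ≡⟨ cong (λ v → ⟦ v ∧ (semiperimeter w ≡ᵇ k) ⟧) (sym (trans (sym (catalan∧avoiding≡valid w)) ok)) ⟩
  weight k w                                   ∎

S≈W⊖𝟏 : S ≈ₛ (W ⊖ 𝟏)
S≈W⊖𝟏 zero    zero    = refl
S≈W⊖𝟏 zero    (suc k) = refl
S≈W⊖𝟏 (suc n) k = begin
  + length (filter (λ w → sper w ℕ.≟ k) (avoidingWords (suc n)))
    ≡⟨ +length (filter (λ w → sper w ℕ.≟ k) (avoidingWords (suc n))) ⟩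
  ∑[ _ ∈ filter (λ w → sper w ℕ.≟ k) (avoidingWords (suc n)) ] + 1
    ≡⟨ ∑-filter (λ w → sper w ℕ.≟ k) (avoidingWords (suc n)) (λ _ → + 1) ⟩
  ∑[ w ∈ avoidingWords (suc n) ] ⟦ does (sper w ℕ.≟ k) ⟧ * + 1
    ≡⟨ ∑-filter (λ w → isCatalan w ∧ avoidsGeGe w Boolₚ.≟ true) (allLists (suc n) (suc n)) _ ⟩
  ∑[ w ∈ allLists (suc n) (suc n) ] ⟦ does (isCatalan w ∧ avoidsGeGe w Boolₚ.≟ true) ⟧ * (⟦ does (sper w ℕ.≟ k) ⟧ * + 1)
    ≡⟨ ∑-cong (allLists (suc n) (suc n)) (filters≡weight k) ⟩
  W (suc n) k
    ≡⟨ sym (ℤₚ.+-identityʳ (W (suc n) k)) ⟩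
  W (suc n) k - 𝟏 (suc n) k ∎

-- The generating function

root≈ : (A ⊖ (mono (+ 2) 2 3 ⊛ S)) ≈ₛ ((𝟏 ⊖ shift 1 2 𝟏) ⊖ (shift 2 3 W ⊕ shift 2 3 W))
root≈ n k = begin
  ((𝟏 n k - mono (+ 1) 1 2 n k) - mono (+ 2) 2 3 n k) - (mono (+ 2) 2 3 ⊛ S) n k
    ≡⟨ cong₂ (λ x y → ((𝟏 n k - x) - y) - (mono (+ 2) 2 3 ⊛ S) n k) (mono≈ (+ 1) 1 2 n k) (mono≈ (+ 2) 2 3 n k) ⟩
  ((𝟏 n k - + 1 * shift 1 2 𝟏 n k) - + 2 * shift 2 3 𝟏 n k) - (mono (+ 2) 2 3 ⊛ S) n k
    ≡⟨ cong (_-_ ((𝟏 n k - + 1 * shift 1 2 𝟏 n k) - + 2 * shift 2 3 𝟏 n k))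
            (trans (mono-⊛ (+ 2) 2 3 S n k) (cong (+ 2 *_) (trans (shift-cong 2 3 S≈W⊖𝟏 n k) (shift-⊖ 2 3 W 𝟏 n k)))) ⟩
  ((𝟏 n k - + 1 * shift 1 2 𝟏 n k) - + 2 * shift 2 3 𝟏 n k) - + 2 * (shift 2 3 W n k - shift 2 3 𝟏 n k)
    ≡⟨ simplify (𝟏 n k) (shift 1 2 𝟏 n k) (shift 2 3 𝟏 n k) (shift 2 3 W n k) ⟩
  (𝟏 n k - shift 1 2 𝟏 n k) - (shift 2 3 W n k + shift 2 3 W n k) ∎
  where
  simplify : ∀ e u v vW → ((e - + 1 * u) - + 2 * v) - + 2 * (vW - v) ≡ (e - u) - (vW + vW)
  simplify = solve-∀

discriminant≈D : ∀ n k → ((𝟏 n k - + 2 * shift 1 2 𝟏 n k) + shift 2 4 𝟏 n k) - + 4 * shift 2 3 𝟏 n k ≡ D n k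
discriminant≈D n k = sym (cong₂ _-_
  (cong₂ _+_ (cong (_-_ (𝟏 n k)) (mono≈ (+ 2) 1 2 n k)) (trans (mono≈ (+ 1) 2 4 n k) (ℤₚ.*-identityˡ _)))
  (mono≈ (+ 4) 2 3 n k))

theorem3p1 : IsSqrt (A ⊖ (mono (+ 2) 2 3 ⊛ S)) D
theorem3p1 = (λ n k → begin
  ((A ⊖ (mono (+ 2) 2 3 ⊛ S)) ⊛ (A ⊖ (mono (+ 2) 2 3 ⊛ S))) n k   ≡⟨ ⊛-cong root≈ root≈ n k ⟩
  (R ⊛ R) n k                                                   ≡⟨ quadratic-root 1 2 2 3 W W-equation n k ⟩
  ((𝟏 n k - + 2 * shift 1 2 𝟏 n k) + shift 2 4 𝟏 n k) - + 4 * shift 2 3 𝟏 n k ≡⟨ discriminant≈D n k ⟩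
  D n k ∎) , refl
  where
  R : Series
  R = (𝟏 ⊖ shift 1 2 𝟏) ⊖ (shift 2 3 W ⊕ shift 2 3 W)
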